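{- Let $G_1$ be a simple connected $r_1$-regular graph with $n_1$ vertices and $m_1$ edges, and let $G_2$ be a simple connected graph with $n_2$ vertices and $m_2$ edges, with signless Laplacians $Q_1,Q_2$. Let $G=G_1\diamond G_2$ be their edge corona, with signless Laplacian $Q$. Then, as an identity of rational functions in $\lambda$, \[ f_Q (\lambda ) = (f_{Q_2 } (\lambda -2))^{m_1 } f_{Q_1 } \left(( - 1)^{n_2}\frac{(\lambda -r_1 n_2)\, f_{Q_2} (\lambda-2 )}{ f_{\overline{Q_2} } ( n_2 - \lambda )} \right)\left( ( - 1)^{n_2} \frac{f_{\overline{Q_2} } \left( n_2 - \lambda \right)}{f_{Q_2} (\lambda-2 )}\right)^{n_1}. \]
   Context: For a simple graph $H$ on $m$ vertices, $Q(H)=D(H)+A(H)$ is its signless Laplacian (degree diagonal matrix plus adjacency matrix). $f_Q(\lambda)=\det(\lambda I-Q)$ for $Q=Q(G)$, $f_{Q_i}(\lambda)=\det(\lambda I_{n_i}-Q_i)$, and $f_{\overline{Q_2}}(\lambda)=\det(\lambda I_{n_2}-Q(\overline{G_2}))$ where $\overline{G_2}$ is the complement of $G_2$. The edge corona $G_1\diamond G_2$ is obtained by taking one copy of $G_1$ and $m_1$ disjoint copies of $G_2$, and, for each $i=1,\dots,m_1$, joining both end-vertices of the $i$-th edge of $G_1$ by edges to every vertex of the $i$-th copy of $G_2$. -}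

module Defs where

open import Data.Bool using (Bool; true; false; if_then_else_; _∧_; not)
open import Data.Nat as ℕ using (ℕ; zero; suc)
open import Data.Fin as Fin using (Fin; zero; suc; punchIn; splitAt; quotRem; _<?_; _≟_)
open import Data.List using (List; []; _∷_; length; lookup; concatMap)
open import Data.List.Base using (allFin)
open import Data.Product using (_×_; _,_; ∃; Σ; proj₁; proj₂)
open import Data.Sum using (inj₁; inj₂)
open import Data.Rational as ℚ using (ℚ; 0ℚ; 1ℚ; _+_; _*_; _-_; -_)
open import Relation.Nullary using (yes; no)
open import Relation.Nullary.Decidable using (⌊_⌋)
open import Relation.Binary.PropositionalEquality using (_≡_; _≢_)

Matrix : ℕ → Set
Matrix n = Fin n → Fin n → ℚ

sumFin : ∀ n → (Fin n → ℚ) → ℚ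
sumFin zero    f = 0ℚ
sumFin (suc n) f = f zero + sumFin n (λ i → f (suc i))

infixr 8 _^_
_^_ : ℚ → ℕ → ℚ
x ^ zero  = 1ℚ
x ^ suc k = x * (x ^ k)

minor : ∀ {n} → Matrix (suc n) → Fin (suc n) → Matrix n
minor M j r c = M (suc r) (punchIn j c)

det : ∀ n → Matrix n → ℚ
det zero    M = 1ℚ
det (suc n) M =
  sumFin (suc n) (λ j → ((- 1ℚ) ^ Fin.toℕ j) * (M zero j * det n (minor M j)))

record SimpleGraph (n : ℕ) : Set where
  field
    adj    : Fin n → Fin n → Bool
    sym    : ∀ i j → adj i j ≡ adj j i
    irrefl : ∀ i → adj i i ≡ false
open SimpleGraph public

data Walk {n : ℕ} (G : SimpleGraph n) : Fin n → Fin n → Set where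
  here : ∀ {i} → Walk G i i
  step : ∀ {i j k} → adj G i j ≡ true → Walk G j k → Walk G i k

Connected : ∀ {n} → SimpleGraph n → Set
Connected G = ∀ i j → Walk G i j

degreeA : ∀ {n} → (Fin n → Fin n → Bool) → Fin n → ℕ
degreeA {n} a i = go n (λ j → a i j)
  where
    go : ∀ k → (Fin k → Bool) → ℕ
    go zero    f = 0
    go (suc k) f = (if f zero then 1 else 0) ℕ.+ go k (λ j → f (suc j))

Regular : ∀ {n} → SimpleGraph n → ℕ → Set
Regular G r = ∀ i → degreeA (adj G) i ≡ r

edges : ∀ {n} → SimpleGraph n → List (Fin n × Fin n)
edges {n} G =
  concatMap (λ i → concatMap (λ j →
    if ⌊ i <? j ⌋ ∧ adj G i j then (i , j) ∷ [] else []) (allFin n)) (allFin n)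

numEdges : ∀ {n} → SimpleGraph n → ℕ
numEdges G = length (edges G)

complAdj : ∀ {n} → SimpleGraph n → Fin n → Fin n → Bool
complAdj G i j = not ⌊ i ≟ j ⌋ ∧ not (adj G i j)

ℕtoℚ : ℕ → ℚ
ℕtoℚ k = (Data.Integer.+ k) ℚ./ 1
  where import Data.Integer

bool→ℚ : Bool → ℚ
bool→ℚ true  = 1ℚ
bool→ℚ false = 0ℚ

signlessQ : ∀ {n} → (Fin n → Fin n → Bool) → Matrix n
signlessQ a i j with i ≟ j
... | yes _ = ℕtoℚ (degreeA a i) + bool→ℚ (a i j)
... | no  _ = bool→ℚ (a i j)

charPolyAt : ∀ n → Matrix n → ℚ → ℚ
charPolyAt n M x = det n (λ i j → (if ⌊ i ≟ j ⌋ then x else 0ℚ) - M i j)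

fQ : ∀ {n} → SimpleGraph n → ℚ → ℚ
fQ {n} G = charPolyAt n (signlessQ (adj G))

fQbar : ∀ {n} → SimpleGraph n → ℚ → ℚ
fQbar {n} G = charPolyAt n (signlessQ (complAdj G))

-- Vertices: Fin (n1 + m1 * n2); the first n1 are the vertices of G1,
-- a vertex in the second block is decoded by quotRem {numEdges G1} n2 as (a , i):
-- vertex a of the i-th copy of G2 (i-th edge of G1 in `edges G1`).

isEndpoint : ∀ {n} → Fin n → Fin n × Fin n → Bool
isEndpoint u (a , b) = ⌊ u ≟ a ⌋ Data.Bool.∨ ⌊ u ≟ b ⌋
  where import Data.Bool

edgeCoronaAdj : ∀ {n1 n2} (G1 : SimpleGraph n1) (G2 : SimpleGraph n2) →
  Fin (n1 ℕ.+ numEdges G1 ℕ.* n2) → Fin (n1 ℕ.+ numEdges G1 ℕ.* n2) → Bool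
edgeCoronaAdj {n1} {n2} G1 G2 x y with splitAt n1 x | splitAt n1 y
... | inj₁ u | inj₁ v = adj G1 u v
... | inj₁ u | inj₂ q = let (b , k) = quotRem {numEdges G1} n2 q in isEndpoint u (lookup (edges G1) k)
... | inj₂ p | inj₁ v = let (a , i) = quotRem {numEdges G1} n2 p in isEndpoint v (lookup (edges G1) i)
... | inj₂ p | inj₂ q =
  let (a , i) = quotRem {numEdges G1} n2 p ; (b , k) = quotRem {numEdges G1} n2 q
  in ⌊ i ≟ k ⌋ ∧ adj G2 a b

fQcorona : ∀ {n1 n2} → SimpleGraph n1 → SimpleGraph n2 → ℚ → ℚ
fQcorona {n1} {n2} G1 G2 =
  charPolyAt (n1 ℕ.+ numEdges G1 ℕ.* n2) (signlessQ (edgeCoronaAdj G1 G2))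

-- Order the vertices of G₁ ⋄ G₂ as V(G₁) followed by the m₁ copies of G₂, and put
-- B = (λ - 2) I - Q(G₂) and R for the vertex-edge incidence matrix of G₁, so R Rᵀ = Q(G₁).
-- Then λ I - Q(G₁ ⋄ G₂) = [[T, -R ⊗ 1ᵀ], [-Rᵀ ⊗ 1, I ⊗ B]] with T = (λ - r₁ - n₂ r₁) I - A(G₁),
-- and eliminating the lower blocks gives f_Q(λ) = f_{Q₂}(λ - 2)^{m₁} · det (T - Γ Q(G₁)), where
-- Γ = 1ᵀ B⁻¹ 1 = Σ z for the solution of zᵀ B = 1ᵀ.  By regularity
-- T - Γ Q(G₁) = (1 + Γ) (μ I - Q(G₁)) with (1 + Γ) μ = λ - r₁ n₂.  Finally
-- Q(Ḡ₂) = (n₂ - 2) I - Q(G₂) + J, so the matrix determinant lemma gives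
-- f_{Q̄₂}(n₂ - λ) = (-1)^{n₂} (1 + Γ) f_{Q₂}(λ - 2), which identifies 1 + Γ and μ.

module Submission where

open import Data.Bool using (Bool; true; false; if_then_else_; _∧_; not)
open import Data.Empty using (⊥-elim)
open import Data.Fin as Fin using (Fin; zero; suc; toℕ; fromℕ<; punchIn; punchOut; _↑ˡ_; _↑ʳ_; splitAt; quotRem; _≟_; _<?_)
import Data.Fin.Properties as Finₚ
import Data.Integer as ℤ
import Data.Integer.Properties as ℤₚ
open import Data.List using (List; []; _∷_; length; lookup; concatMap; _++_; tabulate)
open import Data.List.Base using (allFin)
open import Data.List.Membership.Propositional.Properties using (∈-lookup)
open import Data.List.Relation.Unary.All as All using (All; []; _∷_)
open import Data.List.Relation.Unary.All.Properties using (concat⁺; map⁺)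
open import Data.Nat as ℕ using (ℕ; zero; suc)
open import Data.Nat.Coprimality using (1-coprimeTo) renaming (sym to coprime-sym)
import Data.Nat.Properties as ℕₚ
open import Data.Product using (Σ-syntax; _×_; _,_; proj₁; proj₂; map₂; uncurry)
open import Data.Rational as ℚ using (ℚ; 0ℚ; 1ℚ; ½; _+_; _*_; _-_; -_; _÷_; 1/_; mkℚ; ≢-nonZero)
open import Data.Rational.Properties
  using (+-identityˡ; +-identityʳ; *-identityˡ; *-identityʳ; *-zeroˡ; *-zeroʳ; *-comm; *-inverseʳ;
         normalize-coprime; toℚᵘ-injective; toℚᵘ-homo-+)
open import Data.Rational.Solver using (module +-*-Solver)
import Data.Rational.Unnormalised as ℚᵘ
import Data.Rational.Unnormalised.Properties as ℚᵘₚ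
open import Data.Sum using (_⊎_; inj₁; inj₂; [_,_]′)
open import Function using (_∘_; id)
open import Relation.Binary.Definitions using (tri<; tri≈; tri>)
open import Relation.Binary.PropositionalEquality
open import Relation.Nullary using (Dec; yes; no; ¬_)
open import Relation.Nullary.Decidable using (⌊_⌋; dec-true; dec-false; isYes≗does)

open import Defs hiding (sym)

open +-*-Solver

⌊⌋-yes : ∀ {a} {A : Set a} (a? : Dec A) → A → ⌊ a? ⌋ ≡ true
⌊⌋-yes a? a = trans (isYes≗does a?) (dec-true a? a)

⌊⌋-no : ∀ {a} {A : Set a} (a? : Dec A) → ¬ A → ⌊ a? ⌋ ≡ false
⌊⌋-no a? ¬a = trans (isYes≗does a?) (dec-false a? ¬a)

ℕtoℚ-suc : ∀ k → ℕtoℚ (suc k) ≡ 1ℚ + ℕtoℚ k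
ℕtoℚ-suc k rewrite normalize-coprime (coprime-sym (1-coprimeTo k))
                 | normalize-coprime (coprime-sym (1-coprimeTo (suc k))) =
  toℚᵘ-injective (ℚᵘₚ.≃-trans (ℚᵘ.*≡* (cong (ℤ._* ℤ.+ 1) numerator))
                              (ℚᵘₚ.≃-sym (toℚᵘ-homo-+ 1ℚ (mkℚ (ℤ.+ k) 0 (coprime-sym (1-coprimeTo k))))))
  where
  numerator : ℤ.+ suc k ≡ ℤ.+ 1 ℤ.* ℤ.+ 1 ℤ.+ ℤ.+ k ℤ.* ℤ.+ 1
  numerator = cong (λ z → ℤ.+ 1 ℤ.+ z) (sym (ℤₚ.*-identityʳ (ℤ.+ k)))

ℕtoℚ-+ : ∀ a b → ℕtoℚ (a ℕ.+ b) ≡ ℕtoℚ a + ℕtoℚ b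
ℕtoℚ-+ zero    b = sym (+-identityˡ (ℕtoℚ b))
ℕtoℚ-+ (suc a) b = begin
  ℕtoℚ (suc a ℕ.+ b)       ≡⟨ ℕtoℚ-suc (a ℕ.+ b) ⟩
  1ℚ + ℕtoℚ (a ℕ.+ b)      ≡⟨ cong (1ℚ +_) (ℕtoℚ-+ a b) ⟩
  1ℚ + (ℕtoℚ a + ℕtoℚ b)   ≡⟨ solve 2 (λ x y → con 1ℚ :+ (x :+ y) := (con 1ℚ :+ x) :+ y) refl (ℕtoℚ a) (ℕtoℚ b) ⟩
  (1ℚ + ℕtoℚ a) + ℕtoℚ b   ≡⟨ cong (_+ ℕtoℚ b) (sym (ℕtoℚ-suc a)) ⟩
  ℕtoℚ (suc a) + ℕtoℚ b    ∎
  where open ≡-Reasoning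

ℕtoℚ-* : ∀ a b → ℕtoℚ (a ℕ.* b) ≡ ℕtoℚ a * ℕtoℚ b
ℕtoℚ-* zero    b = sym (*-zeroˡ (ℕtoℚ b))
ℕtoℚ-* (suc a) b = begin
  ℕtoℚ (b ℕ.+ a ℕ.* b)        ≡⟨ ℕtoℚ-+ b (a ℕ.* b) ⟩
  ℕtoℚ b + ℕtoℚ (a ℕ.* b)     ≡⟨ cong (ℕtoℚ b +_) (ℕtoℚ-* a b) ⟩
  ℕtoℚ b + ℕtoℚ a * ℕtoℚ b    ≡⟨ solve 2 (λ x y → y :+ x :* y := (con 1ℚ :+ x) :* y) refl (ℕtoℚ a) (ℕtoℚ b) ⟩
  (1ℚ + ℕtoℚ a) * ℕtoℚ b      ≡⟨ cong (_* ℕtoℚ b) (sym (ℕtoℚ-suc a)) ⟩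
  ℕtoℚ (suc a) * ℕtoℚ b       ∎
  where open ≡-Reasoning

-- Finite sums

sum-cong : ∀ n {f g : Fin n → ℚ} → (∀ i → f i ≡ g i) → sumFin n f ≡ sumFin n g
sum-cong zero    f≡g = refl
sum-cong (suc n) f≡g = cong₂ _+_ (f≡g zero) (sum-cong n (f≡g ∘ suc))

sum-zero : ∀ n {f : Fin n → ℚ} → (∀ i → f i ≡ 0ℚ) → sumFin n f ≡ 0ℚ
sum-zero zero    f≡0 = refl
sum-zero (suc n) f≡0 = cong₂ _+_ (f≡0 zero) (sum-zero n (f≡0 ∘ suc))

sum-distrib-+ : ∀ n (f g : Fin n → ℚ) → sumFin n (λ i → f i + g i) ≡ sumFin n f + sumFin n g
sum-distrib-+ zero    f g = refl
sum-distrib-+ (suc n) f g =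
  trans (cong (f zero + g zero +_) (sum-distrib-+ n (f ∘ suc) (g ∘ suc)))
        (solve 4 (λ a b c d → (a :+ b) :+ (c :+ d) := (a :+ c) :+ (b :+ d)) refl (f zero) (g zero) _ _)

*-distribˡ-sum : ∀ n (c : ℚ) (f : Fin n → ℚ) → sumFin n (λ i → c * f i) ≡ c * sumFin n f
*-distribˡ-sum zero    c f = sym (*-zeroʳ c)
*-distribˡ-sum (suc n) c f =
  trans (cong (c * f zero +_) (*-distribˡ-sum n c (f ∘ suc)))
        (solve 3 (λ c a b → c :* a :+ c :* b := c :* (a :+ b)) refl c (f zero) _)

*-distribʳ-sum : ∀ n (c : ℚ) (f : Fin n → ℚ) → sumFin n (λ i → f i * c) ≡ sumFin n f * c
*-distribʳ-sum n c f =
  trans (sum-cong n (λ i → *-comm (f i) c)) (trans (*-distribˡ-sum n c f) (*-comm c _))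

neg-distrib-sum : ∀ n (f : Fin n → ℚ) → sumFin n (λ i → - f i) ≡ - sumFin n f
neg-distrib-sum n f =
  trans (sum-cong n (λ i → solve 1 (λ a → :- a := (:- con 1ℚ) :* a) refl (f i)))
        (trans (*-distribˡ-sum n (- 1ℚ) f) (solve 1 (λ a → (:- con 1ℚ) :* a := :- a) refl _))

sum-comm : ∀ n m (f : Fin n → Fin m → ℚ) →
  sumFin n (λ i → sumFin m (f i)) ≡ sumFin m (λ j → sumFin n (λ i → f i j))
sum-comm zero    m f = sym (sum-zero m (λ _ → refl))
sum-comm (suc n) m f =
  trans (cong (sumFin m (f zero) +_) (sum-comm n m (f ∘ suc)))
        (sym (sum-distrib-+ m (f zero) (λ j → sumFin n (λ i → f (suc i) j))))

sum-splitAt : ∀ a b (f : Fin (a ℕ.+ b) → ℚ) →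
  sumFin (a ℕ.+ b) f ≡ sumFin a (λ i → f (i ↑ˡ b)) + sumFin b (λ j → f (a ↑ʳ j))
sum-splitAt zero    b f = sym (+-identityˡ _)
sum-splitAt (suc a) b f =
  trans (cong (f zero +_) (sum-splitAt a b (f ∘ suc)))
        (solve 3 (λ x y z → x :+ (y :+ z) := (x :+ y) :+ z) refl (f zero) _ _)

sum-punchIn : ∀ n (i : Fin (suc n)) (f : Fin (suc n) → ℚ) →
  sumFin (suc n) f ≡ f i + sumFin n (f ∘ punchIn i)
sum-punchIn n       zero    f = refl
sum-punchIn (suc n) (suc i) f =
  trans (cong (f zero +_) (sum-punchIn n i (f ∘ suc)))
        (solve 3 (λ x y z → x :+ (y :+ z) := y :+ (x :+ z)) refl (f zero) (f (suc i)) _)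

sum-single : ∀ n (i : Fin n) (f : Fin n → ℚ) → (∀ j → j ≢ i → f j ≡ 0ℚ) → sumFin n f ≡ f i
sum-single (suc n) i f f≡0 =
  trans (sum-punchIn n i f)
        (trans (cong (f i +_) (sum-zero n (λ k → f≡0 (punchIn i k) (Finₚ.punchInᵢ≢i i k))))
               (+-identityʳ (f i)))

sum-const : ∀ n (c : ℚ) → sumFin n (λ _ → c) ≡ ℕtoℚ n * c
sum-const zero    c = sym (*-zeroˡ c)
sum-const (suc n) c =
  trans (cong (c +_) (sum-const n c))
        (trans (solve 2 (λ c x → c :+ x :* c := (con 1ℚ :+ x) :* c) refl c (ℕtoℚ n))
               (cong (_* c) (sym (ℕtoℚ-suc n))))

quotRem-↑ˡ : ∀ m k (a : Fin k) → quotRem {suc m} k (a ↑ˡ m ℕ.* k) ≡ (a , zero)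
quotRem-↑ˡ m k a rewrite Finₚ.splitAt-↑ˡ k a (m ℕ.* k) = refl

quotRem-↑ʳ : ∀ m k (x : Fin (m ℕ.* k)) → quotRem {suc m} k (k ↑ʳ x) ≡ map₂ suc (quotRem {m} k x)
quotRem-↑ʳ m k x rewrite Finₚ.splitAt-↑ʳ k (m ℕ.* k) x = refl

sum-quotRem : ∀ m k (f : Fin (m ℕ.* k) → ℚ) (g : Fin k → Fin m → ℚ) →
  (∀ x → f x ≡ uncurry g (quotRem {m} k x)) →
  sumFin (m ℕ.* k) f ≡ sumFin m (λ i → sumFin k (λ a → g a i))
sum-quotRem zero    k f g f≡g = refl
sum-quotRem (suc m) k f g f≡g =
  trans (sum-splitAt k (m ℕ.* k) f)
        (cong₂ _+_ (sum-cong k (λ a → trans (f≡g (a ↑ˡ m ℕ.* k)) (cong (uncurry g) (quotRem-↑ˡ m k a))))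
                   (sum-quotRem m k _ (λ a i → g a (suc i))
                      (λ x → trans (f≡g (k ↑ʳ x)) (cong (uncurry g) (quotRem-↑ʳ m k x)))))

-- Determinants

sign : ℕ → ℚ
sign k = (- 1ℚ) ^ k

sign-*-sign : ∀ n → sign n * sign n ≡ 1ℚ
sign-*-sign zero    = refl
sign-*-sign (suc n) =
  trans (solve 1 (λ s → ((:- con 1ℚ) :* s) :* ((:- con 1ℚ) :* s) := s :* s) refl (sign n)) (sign-*-sign n)

laplaceTerm : ∀ n → Matrix (suc n) → Fin (suc n) → ℚ
laplaceTerm n M j = sign (toℕ j) * (M zero j * det n (minor M j))

det-cong : ∀ n {A B : Matrix n} → (∀ i j → A i j ≡ B i j) → det n A ≡ det n B
det-cong zero    A≡B = refl
det-cong (suc n) A≡B = sum-cong (suc n) (λ j →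
  cong₂ (λ x y → sign (toℕ j) * (x * y)) (A≡B zero j) (det-cong n (λ r c → A≡B (suc r) (punchIn j c))))

det-additive-row : ∀ n (r : Fin n) (A B C : Matrix n) →
  (∀ i j → i ≢ r → C i j ≡ A i j) → (∀ i j → i ≢ r → C i j ≡ B i j) →
  (∀ j → C r j ≡ A r j + B r j) → det n C ≡ det n A + det n B
det-additive-row (suc n) zero A B C C≡A C≡B Cr =
  trans (sum-cong (suc n) (λ j → trans
          (cong₂ (λ x y → sign (toℕ j) * (x * y)) (Cr j) (det-cong n (λ r c → C≡A (suc r) (punchIn j c) λ ())))
          (trans (solve 4 (λ s a b d → s :* ((a :+ b) :* d) := s :* (a :* d) :+ s :* (b :* d)) refl
                          (sign (toℕ j)) (A zero j) (B zero j) (det n (minor A j)))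
                 (cong (λ d → laplaceTerm n A j + sign (toℕ j) * (B zero j * d))
                       (det-cong n (λ r c → trans (sym (C≡A (suc r) (punchIn j c) λ ())) (C≡B (suc r) (punchIn j c) λ ())))))))
        (sum-distrib-+ (suc n) (laplaceTerm n A) (laplaceTerm n B))
det-additive-row (suc n) (suc r) A B C C≡A C≡B Cr =
  trans (sum-cong (suc n) (λ j → trans
          (cong (λ y → sign (toℕ j) * (C zero j * y))
                (det-additive-row n r (minor A j) (minor B j) (minor C j)
                   (λ i c i≢r → C≡A (suc i) (punchIn j c) (i≢r ∘ Finₚ.suc-injective))
                   (λ i c i≢r → C≡B (suc i) (punchIn j c) (i≢r ∘ Finₚ.suc-injective))
                   (Cr ∘ punchIn j)))
          (trans (solve 4 (λ s a d e → s :* (a :* (d :+ e)) := s :* (a :* d) :+ s :* (a :* e)) refl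
                          (sign (toℕ j)) (C zero j) (det n (minor A j)) (det n (minor B j)))
                 (cong₂ (λ x y → sign (toℕ j) * (x * det n (minor A j)) + sign (toℕ j) * (y * det n (minor B j)))
                        (C≡A zero j λ ()) (C≡B zero j λ ())))))
        (sum-distrib-+ (suc n) (laplaceTerm n A) (laplaceTerm n B))

det-homogeneous-row : ∀ n (r : Fin n) (c : ℚ) (A C : Matrix n) →
  (∀ i j → i ≢ r → C i j ≡ A i j) → (∀ j → C r j ≡ c * A r j) → det n C ≡ c * det n A
det-homogeneous-row (suc n) zero c A C C≡A Cr =
  trans (sum-cong (suc n) (λ j → trans
          (cong₂ (λ x y → sign (toℕ j) * (x * y)) (Cr j) (det-cong n (λ r k → C≡A (suc r) (punchIn j k) λ ())))
          (solve 4 (λ s c a d → s :* ((c :* a) :* d) := c :* (s :* (a :* d))) refl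
                 (sign (toℕ j)) c (A zero j) (det n (minor A j)))))
        (*-distribˡ-sum (suc n) c (laplaceTerm n A))
det-homogeneous-row (suc n) (suc r) c A C C≡A Cr =
  trans (sum-cong (suc n) (λ j → trans
          (cong₂ (λ x y → sign (toℕ j) * (x * y)) (C≡A zero j λ ())
                 (det-homogeneous-row n r c (minor A j) (minor C j)
                    (λ i k i≢r → C≡A (suc i) (punchIn j k) (i≢r ∘ Finₚ.suc-injective))
                    (Cr ∘ punchIn j)))
          (solve 4 (λ s c a d → s :* (a :* (c :* d)) := c :* (s :* (a :* d))) refl
                 (sign (toℕ j)) c (A zero j) (det n (minor A j)))))
        (*-distribˡ-sum (suc n) c (laplaceTerm n A))

-- Expanding along rows 0 and 1 at once: the (a, b) term uses columns a and b of
-- those rows; the swapped pair (b, a) produces the same minor with the opposite sign.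
sign-punchOut-swap : ∀ {n} (a b : Fin (suc n)) (a≢b : a ≢ b) (b≢a : b ≢ a) →
  sign (toℕ a) * sign (toℕ (punchOut a≢b)) ≡ - (sign (toℕ b) * sign (toℕ (punchOut b≢a)))
sign-punchOut-swap zero zero a≢b b≢a = ⊥-elim (a≢b refl)
sign-punchOut-swap {suc n} zero (suc b) a≢b b≢a =
  solve 1 (λ s → con 1ℚ :* s := :- (((:- con 1ℚ) :* s) :* con 1ℚ)) refl (sign (toℕ b))
sign-punchOut-swap {suc n} (suc a) zero a≢b b≢a =
  solve 1 (λ s → ((:- con 1ℚ) :* s) :* con 1ℚ := :- (con 1ℚ :* s)) refl (sign (toℕ a))
sign-punchOut-swap {suc n} (suc a) (suc b) a≢b b≢a =
  trans (solve 2 (λ x y → ((:- con 1ℚ) :* x) :* ((:- con 1ℚ) :* y) := x :* y) refl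
                 (sign (toℕ a)) (sign (toℕ (punchOut (a≢b ∘ cong suc)))))
  (trans (sign-punchOut-swap a b (a≢b ∘ cong suc) (b≢a ∘ cong suc))
         (solve 2 (λ x y → :- (x :* y) := :- (((:- con 1ℚ) :* x) :* ((:- con 1ℚ) :* y))) refl
                (sign (toℕ b)) (sign (toℕ (punchOut (b≢a ∘ cong suc))))))

punchIn-punchOut-swap : ∀ {n} (a b : Fin (suc (suc n))) (a≢b : a ≢ b) (b≢a : b ≢ a) (c : Fin n) →
  punchIn a (punchIn (punchOut a≢b) c) ≡ punchIn b (punchIn (punchOut b≢a) c)
punchIn-punchOut-swap zero    zero    a≢b b≢a c = ⊥-elim (a≢b refl)
punchIn-punchOut-swap zero    (suc b) a≢b b≢a c = refl
punchIn-punchOut-swap (suc a) zero    a≢b b≢a c = refl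
punchIn-punchOut-swap {suc n} (suc a) (suc b) a≢b b≢a zero    = refl
punchIn-punchOut-swap {suc n} (suc a) (suc b) a≢b b≢a (suc c) =
  cong suc (punchIn-punchOut-swap a b (a≢b ∘ cong suc) (b≢a ∘ cong suc) c)

twoRowTerm : ∀ n → Matrix (suc (suc n)) → Fin (suc (suc n)) → Fin (suc (suc n)) → ℚ
twoRowTerm n M a b with a ≟ b
... | yes _   = 0ℚ
... | no a≢b  = sign (toℕ a) * (M zero a * (sign (toℕ (punchOut a≢b))
                  * (M (suc zero) b * det n (minor (minor M a) (punchOut a≢b)))))

det-expand-two-rows : ∀ n (M : Matrix (suc (suc n))) →
  det (suc (suc n)) M ≡ sumFin (suc (suc n)) (λ a → sumFin (suc (suc n)) (twoRowTerm n M a))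
det-expand-two-rows n M = sum-cong (suc (suc n)) row
  where
  diagonal : ∀ a → twoRowTerm n M a a ≡ 0ℚ
  diagonal a with a ≟ a
  ... | yes _   = refl
  ... | no a≢a  = ⊥-elim (a≢a refl)
  offDiagonal : ∀ a k → twoRowTerm n M a (punchIn a k) ≡ sign (toℕ a) * (M zero a * laplaceTerm n (minor M a) k)
  offDiagonal a k with a ≟ punchIn a k
  ... | yes a≡ = ⊥-elim (Finₚ.punchInᵢ≢i a k (sym a≡))
  ... | no a≢  = cong (λ q → sign (toℕ a) * (M zero a * (sign (toℕ q)
                               * (M (suc zero) (punchIn a k) * det n (minor (minor M a) q)))))
                      (trans (Finₚ.punchOut-cong a refl) (Finₚ.punchOut-punchIn a))
  row : ∀ a → laplaceTerm (suc n) M a ≡ sumFin (suc (suc n)) (twoRowTerm n M a)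
  row a = begin
    sign (toℕ a) * (M zero a * sumFin (suc n) (laplaceTerm n (minor M a)))
      ≡⟨ cong (sign (toℕ a) *_) (sym (*-distribˡ-sum (suc n) (M zero a) (laplaceTerm n (minor M a)))) ⟩
    sign (toℕ a) * sumFin (suc n) (λ k → M zero a * laplaceTerm n (minor M a) k)
      ≡⟨ sym (*-distribˡ-sum (suc n) (sign (toℕ a)) (λ k → M zero a * laplaceTerm n (minor M a) k)) ⟩
    sumFin (suc n) (λ k → sign (toℕ a) * (M zero a * laplaceTerm n (minor M a) k))
      ≡⟨ sum-cong (suc n) (λ k → sym (offDiagonal a k)) ⟩
    sumFin (suc n) (twoRowTerm n M a ∘ punchIn a)
      ≡⟨ sym (+-identityˡ (sumFin (suc n) (twoRowTerm n M a ∘ punchIn a))) ⟩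
    0ℚ + sumFin (suc n) (twoRowTerm n M a ∘ punchIn a)
      ≡⟨ cong (_+ sumFin (suc n) (twoRowTerm n M a ∘ punchIn a)) (sym (diagonal a)) ⟩
    twoRowTerm n M a a + sumFin (suc n) (twoRowTerm n M a ∘ punchIn a)
      ≡⟨ sym (sum-punchIn (suc n) a (twoRowTerm n M a)) ⟩
    sumFin (suc (suc n)) (twoRowTerm n M a) ∎
    where open ≡-Reasoning

twoRowTerm-swap : ∀ n (M M' : Matrix (suc (suc n))) →
  (∀ j → M' zero j ≡ M (suc zero) j) → (∀ j → M' (suc zero) j ≡ M zero j) →
  (∀ i j → M' (suc (suc i)) j ≡ M (suc (suc i)) j) →
  ∀ a b → twoRowTerm n M' a b ≡ - twoRowTerm n M b a
twoRowTerm-swap n M M' row₀ row₁ rows a b with a ≟ b | b ≟ a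
... | yes _   | yes _   = refl
... | yes a≡b | no b≢a  = ⊥-elim (b≢a (sym a≡b))
... | no a≢b  | yes b≡a = ⊥-elim (a≢b (sym b≡a))
... | no a≢b  | no b≢a  = begin
  sa * (M' zero a * (sp * (M' (suc zero) b * d')))  ≡⟨ cong₂ (λ x y → sa * (x * (sp * (y * d')))) (row₀ a) (row₁ b) ⟩
  sa * (x * (sp * (y * d')))                        ≡⟨ cong (λ d → sa * (x * (sp * (y * d)))) d'≡d ⟩
  sa * (x * (sp * (y * d)))                         ≡⟨ solve 5 (λ sa sp x y d → sa :* (x :* (sp :* (y :* d))) := (sa :* sp) :* (x :* y :* d)) refl sa sp x y d ⟩
  (sa * sp) * (x * y * d)                           ≡⟨ cong (_* (x * y * d)) (sign-punchOut-swap a b a≢b b≢a) ⟩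
  - (sb * sq) * (x * y * d)                         ≡⟨ solve 5 (λ sb sq x y d → (:- (sb :* sq)) :* (x :* y :* d) := :- (sb :* (y :* (sq :* (x :* d))))) refl sb sq x y d ⟩
  - (sb * (y * (sq * (x * d))))                     ∎
  where
  open ≡-Reasoning
  sa = sign (toℕ a)
  sb = sign (toℕ b)
  sp = sign (toℕ (punchOut a≢b))
  sq = sign (toℕ (punchOut b≢a))
  x = M (suc zero) a
  y = M zero b
  d' = det n (minor (minor M' a) (punchOut a≢b))
  d = det n (minor (minor M b) (punchOut b≢a))
  d'≡d : d' ≡ d
  d'≡d = det-cong n (λ r c → trans (rows r _) (cong (M (suc (suc r))) (punchIn-punchOut-swap a b a≢b b≢a c)))

det-swap₀₁ : ∀ n (M M' : Matrix (suc (suc n))) →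
  (∀ j → M' zero j ≡ M (suc zero) j) → (∀ j → M' (suc zero) j ≡ M zero j) →
  (∀ i j → M' (suc (suc i)) j ≡ M (suc (suc i)) j) →
  det (suc (suc n)) M' ≡ - det (suc (suc n)) M
det-swap₀₁ n M M' row₀ row₁ rows = begin
  det (2+ n) M'                                       ≡⟨ det-expand-two-rows n M' ⟩
  sumFin (2+ n) (λ a → sumFin (2+ n) (twoRowTerm n M' a))
    ≡⟨ sum-cong (2+ n) (λ a → trans (sum-cong (2+ n) (twoRowTerm-swap n M M' row₀ row₁ rows a))
                                    (neg-distrib-sum (2+ n) (λ b → twoRowTerm n M b a))) ⟩
  sumFin (2+ n) (λ a → - sumFin (2+ n) (λ b → twoRowTerm n M b a))
    ≡⟨ neg-distrib-sum (2+ n) (λ a → sumFin (2+ n) (λ b → twoRowTerm n M b a)) ⟩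
  - sumFin (2+ n) (λ a → sumFin (2+ n) (λ b → twoRowTerm n M b a))
    ≡⟨ cong -_ (sum-comm (2+ n) (2+ n) (λ a b → twoRowTerm n M b a)) ⟩
  - sumFin (2+ n) (λ b → sumFin (2+ n) (twoRowTerm n M b))
    ≡⟨ cong -_ (sym (det-expand-two-rows n M)) ⟩
  - det (2+ n) M                                      ∎
  where
  open ≡-Reasoning
  2+ : ℕ → ℕ
  2+ k = suc (suc k)

x≡-x⇒x≡0 : ∀ x → x ≡ - x → x ≡ 0ℚ
x≡-x⇒x≡0 x x≡-x =
  trans (solve 1 (λ x → x := con ½ :* (x :+ x)) refl x)
        (trans (cong (λ y → ½ * (x + y)) x≡-x) (solve 1 (λ x → con ½ :* (x :+ (:- x)) := con 0ℚ) refl x))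

swapRows₀₁ : ∀ {n} → Matrix (suc (suc n)) → Matrix (suc (suc n))
swapRows₀₁ M zero          = M (suc zero)
swapRows₀₁ M (suc zero)    = M zero
swapRows₀₁ M (suc (suc i)) = M (suc (suc i))

mutual
  det-equal-rows : ∀ n (M : Matrix n) (i k : Fin n) → i ≢ k → (∀ j → M i j ≡ M k j) → det n M ≡ 0ℚ
  det-equal-rows (suc n) M zero    zero    i≢k Mi≡Mk = ⊥-elim (i≢k refl)
  det-equal-rows (suc n) M zero    (suc k) i≢k Mi≡Mk = det-equal-top-row n M k Mi≡Mk
  det-equal-rows (suc n) M (suc i) zero    i≢k Mi≡Mk = det-equal-top-row n M i (sym ∘ Mi≡Mk)
  det-equal-rows (suc n) M (suc i) (suc k) i≢k Mi≡Mk = det-equal-lower-rows n M i k (i≢k ∘ cong suc) Mi≡Mk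

  det-equal-lower-rows : ∀ n (M : Matrix (suc n)) (i k : Fin n) → i ≢ k →
    (∀ j → M (suc i) j ≡ M (suc k) j) → det (suc n) M ≡ 0ℚ
  det-equal-lower-rows n M i k i≢k Mi≡Mk = sum-zero (suc n) (λ j →
    trans (cong (λ z → sign (toℕ j) * (M zero j * z))
                (det-equal-rows n (minor M j) i k i≢k (Mi≡Mk ∘ punchIn j)))
          (solve 2 (λ s x → s :* (x :* con 0ℚ) := con 0ℚ) refl (sign (toℕ j)) (M zero j)))

  -- Swapping rows 0 and 1 either fixes M (and det M = - det M) or moves the repeated
  -- row off the top.
  det-equal-top-row : ∀ n (M : Matrix (suc n)) (k : Fin n) → (∀ j → M zero j ≡ M (suc k) j) → det (suc n) M ≡ 0ℚ
  det-equal-top-row (suc n) M zero    M₀≡Mk = x≡-x⇒x≡0 _ (det-swap₀₁ n M M M₀≡Mk (sym ∘ M₀≡Mk) (λ i j → refl))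
  det-equal-top-row (suc n) M (suc k) M₀≡Mk =
    trans (solve 1 (λ x → x := :- (:- x)) refl (det (suc (suc n)) M))
          (trans (cong -_ (sym (det-swap₀₁ n M (swapRows₀₁ M) (λ j → refl) (λ j → refl) (λ i j → refl))))
                 (cong -_ (det-equal-lower-rows (suc n) (swapRows₀₁ M) zero (suc k) (λ ()) M₀≡Mk)))

setRow : ∀ {n} → Matrix n → Fin n → (Fin n → ℚ) → Matrix n
setRow M r v i j with i ≟ r
... | yes _ = v j
... | no _  = M i j

setRow-≡ : ∀ {n} (M : Matrix n) r v j → setRow M r v r j ≡ v j
setRow-≡ M r v j with r ≟ r
... | yes _   = refl
... | no r≢r  = ⊥-elim (r≢r refl)

setRow-≢ : ∀ {n} (M : Matrix n) r v i j → i ≢ r → setRow M r v i j ≡ M i j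
setRow-≢ M r v i j i≢r with i ≟ r
... | yes i≡r = ⊥-elim (i≢r i≡r)
... | no _    = refl

det-linear-row : ∀ n (r : Fin n) (M : Matrix n) (m : ℕ) (c : Fin m → ℚ) (V : Fin m → Fin n → ℚ) (C : Matrix n) →
  (∀ i j → i ≢ r → C i j ≡ M i j) → (∀ j → C r j ≡ sumFin m (λ s → c s * V s j)) →
  det n C ≡ sumFin m (λ s → c s * det n (setRow M r (V s)))
det-linear-row n r M zero c V C C≡M Cr =
  trans (det-homogeneous-row n r 0ℚ M C C≡M (λ j → trans (Cr j) (sym (*-zeroˡ (M r j)))))
        (*-zeroˡ (det n M))
det-linear-row n r M (suc m) c V C C≡M Cr =
  trans (det-additive-row n r (setRow C r first) (setRow C r rest) C
           (λ i j i≢r → sym (setRow-≢ C r first i j i≢r)) (λ i j i≢r → sym (setRow-≢ C r rest i j i≢r))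
           (λ j → trans (Cr j) (sym (cong₂ _+_ (setRow-≡ C r first j) (setRow-≡ C r rest j)))))
        (cong₂ _+_
           (det-homogeneous-row n r (c zero) (setRow M r (V zero)) (setRow C r first)
              (λ i j i≢r → trans (setRow-≢ C r first i j i≢r) (trans (C≡M i j i≢r) (sym (setRow-≢ M r (V zero) i j i≢r))))
              (λ j → trans (setRow-≡ C r first j) (cong (c zero *_) (sym (setRow-≡ M r (V zero) j)))))
           (det-linear-row n r M m (c ∘ suc) (V ∘ suc) (setRow C r rest)
              (λ i j i≢r → trans (setRow-≢ C r rest i j i≢r) (C≡M i j i≢r)) (setRow-≡ C r rest)))
  where
  first rest : Fin n → ℚ
  first j = c zero * V zero j
  rest j = sumFin m (λ s → c (suc s) * V (suc s) j)

det-add-row-combination : ∀ n (r : Fin n) (M C : Matrix n) (c : Fin n → ℚ) → c r ≡ 0ℚ →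
  (∀ i j → i ≢ r → C i j ≡ M i j) → (∀ j → C r j ≡ M r j + sumFin n (λ s → c s * M s j)) →
  det n C ≡ det n M
det-add-row-combination n r M C c cr≡0 C≡M Cr =
  trans (det-additive-row n r M (setRow M r combination) C
           C≡M (λ i j i≢r → trans (C≡M i j i≢r) (sym (setRow-≢ M r combination i j i≢r)))
           (λ j → trans (Cr j) (cong (M r j +_) (sym (setRow-≡ M r combination j)))))
        (trans (cong (det n M +_)
                 (trans (det-linear-row n r M n c M (setRow M r combination) (setRow-≢ M r combination) (setRow-≡ M r combination))
                        (sum-zero n vanishing)))
               (+-identityʳ (det n M)))
  where
  combination : Fin n → ℚ
  combination j = sumFin n (λ s → c s * M s j)
  vanishing : ∀ s → c s * det n (setRow M r (M s)) ≡ 0ℚ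
  vanishing s with s ≟ r
  ... | yes refl = trans (cong (_* det n (setRow M r (M s))) cr≡0) (*-zeroˡ (det n (setRow M r (M s))))
  ... | no s≢r   = trans (cong (c s *_) (det-equal-rows n (setRow M r (M s)) r s (s≢r ∘ sym)
                                          (λ j → trans (setRow-≡ M r (M s) j) (sym (setRow-≢ M r (M s) s j s≢r)))))
                         (*-zeroʳ (c s))

-- Row i gains Σ_s c i s · (row s); only source rows are added, and source rows gain nothing.
-- Done one row at a time, the sources are never altered, so each step is a single row operation.
module _ (n : ℕ) (M : Matrix n) (c : Fin n → Fin n → ℚ) (source : Fin n → Bool)
         (from-source : ∀ i s → source s ≡ false → c i s ≡ 0ℚ)
         (into-target : ∀ i s → source i ≡ true → c i s ≡ 0ℚ) where

  private
    before : ℕ → Fin n → Bool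
    before t i = ⌊ toℕ i ℕ.<? t ⌋

    partial : ℕ → Matrix n
    partial t i j = M i j + sumFin n (λ s → (if before t i then c i s else 0ℚ) * M s j)

    partial-0 : ∀ i j → partial 0 i j ≡ M i j
    partial-0 i j = trans (cong (M i j +_) (sum-zero n (λ s → *-zeroˡ (M s j)))) (+-identityʳ (M i j))

    partial-source : ∀ t s j → source s ≡ true → partial t s j ≡ M s j
    partial-source t s j src = trans (cong (M s j +_) (sum-zero n vanishing)) (+-identityʳ (M s j))
      where
      vanishing : ∀ s' → (if before t s then c s s' else 0ℚ) * M s' j ≡ 0ℚ
      vanishing s' with before t s
      ... | true  = trans (cong (_* M s' j) (into-target s s' src)) (*-zeroˡ (M s' j))
      ... | false = *-zeroˡ (M s' j)

    c-diagonal : ∀ r → c r r ≡ 0ℚ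
    c-diagonal r with source r in eq
    ... | true  = into-target r r eq
    ... | false = from-source r r eq

    before-suc-≢ : ∀ t i → toℕ i ≢ t → before (suc t) i ≡ before t i
    before-suc-≢ t i i≢t with toℕ i ℕ.<? t
    ... | yes i<t = ⌊⌋-yes (toℕ i ℕ.<? suc t) (ℕₚ.m<n⇒m<1+n i<t)
    ... | no  i≮t = ⌊⌋-no (toℕ i ℕ.<? suc t) ([ i≮t , i≢t ]′ ∘ ℕₚ.m<1+n⇒m<n∨m≡n)

    advance : ∀ t → (t<n : t ℕ.< n) → det n (partial (suc t)) ≡ det n (partial t)
    advance t t<n = det-add-row-combination n r (partial t) (partial (suc t)) (c r) (c-diagonal r) other-rows row-r
      where
      r = fromℕ< t<n
      r≡t : toℕ r ≡ t
      r≡t = Finₚ.toℕ-fromℕ< t<n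
      coefficient : ∀ {u} → before u r ≡ ⌊ t ℕ.<? u ⌋
      coefficient {u} = cong (λ q → ⌊ q ℕ.<? u ⌋) r≡t
      other-rows : ∀ i j → i ≢ r → partial (suc t) i j ≡ partial t i j
      other-rows i j i≢r = cong (M i j +_) (sum-cong n (λ s → cong (λ b → (if b then c i s else 0ℚ) * M s j)
        (before-suc-≢ t i (i≢r ∘ Finₚ.toℕ-injective ∘ (λ e → trans e (sym r≡t))))))
      source-rows : ∀ s j → c r s * M s j ≡ c r s * partial t s j
      source-rows s j with source s in eq
      ... | true  = cong (c r s *_) (sym (partial-source t s j eq))
      ... | false = trans (cong (_* M s j) (from-source r s eq))
                          (trans (*-zeroˡ (M s j)) (sym (trans (cong (_* partial t s j) (from-source r s eq)) (*-zeroˡ (partial t s j)))))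
      row-r : ∀ j → partial (suc t) r j ≡ partial t r j + sumFin n (λ s → c r s * partial t s j)
      row-r j = begin
        M r j + sumFin n (λ s → (if before (suc t) r then c r s else 0ℚ) * M s j)
          ≡⟨ cong (M r j +_) (sum-cong n (λ s → trans (cong (λ b → (if b then c r s else 0ℚ) * M s j)
               (trans coefficient (⌊⌋-yes (t ℕ.<? suc t) (ℕₚ.n<1+n t)))) (source-rows s j))) ⟩
        M r j + sumFin n (λ s → c r s * partial t s j)
          ≡⟨ cong (_+ sumFin n (λ s → c r s * partial t s j)) (sym (trans (cong (M r j +_) (sum-zero n (λ s →
               trans (cong (λ b → (if b then c r s else 0ℚ) * M s j) (trans coefficient (⌊⌋-no (t ℕ.<? t) (ℕₚ.n≮n t))))
                     (*-zeroˡ (M s j))))) (+-identityʳ (M r j)))) ⟩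
        partial t r j + sumFin n (λ s → c r s * partial t s j) ∎
        where open ≡-Reasoning

    det-partial : ∀ t → t ℕ.≤ n → det n (partial t) ≡ det n M
    det-partial zero    _   = det-cong n partial-0
    det-partial (suc t) t<n = trans (advance t t<n) (det-partial t (ℕₚ.<⇒≤ t<n))

  det-add-source-rows : det n (λ i j → M i j + sumFin n (λ s → c i s * M s j)) ≡ det n M
  det-add-source-rows =
    trans (det-cong n (λ i j → cong (M i j +_) (sum-cong n (λ s → cong (λ b → (if b then c i s else 0ℚ) * M s j)
             (sym (⌊⌋-yes (toℕ i ℕ.<? n) (Finₚ.toℕ<n i)))))))
          (det-partial n ℕₚ.≤-refl)

punchIn-↑ˡ : ∀ {a} d (j : Fin (suc a)) (c : Fin a) → punchIn (j ↑ˡ d) (c ↑ˡ d) ≡ punchIn j c ↑ˡ d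
punchIn-↑ˡ d zero    c       = refl
punchIn-↑ˡ d (suc j) zero    = refl
punchIn-↑ˡ d (suc j) (suc c) = cong suc (punchIn-↑ˡ d j c)

punchIn-↑ʳ : ∀ {a} d (j : Fin (suc a)) (c : Fin d) → punchIn (j ↑ˡ d) (a ↑ʳ c) ≡ suc a ↑ʳ c
punchIn-↑ʳ         d zero    c = refl
punchIn-↑ʳ {suc a} d (suc j) c = cong suc (punchIn-↑ʳ d j c)

det-blockTriangular : ∀ a d (M : Matrix (a ℕ.+ d)) → (∀ i j → M (i ↑ˡ d) (a ↑ʳ j) ≡ 0ℚ) →
  det (a ℕ.+ d) M ≡ det a (λ i j → M (i ↑ˡ d) (j ↑ˡ d)) * det d (λ i j → M (a ↑ʳ i) (a ↑ʳ j))
det-blockTriangular zero    d M upper≡0 = sym (*-identityˡ (det d M))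
det-blockTriangular (suc a) d M upper≡0 = begin
  sumFin (suc a ℕ.+ d) (laplaceTerm (a ℕ.+ d) M)
    ≡⟨ sum-splitAt (suc a) d (laplaceTerm (a ℕ.+ d) M) ⟩
  sumFin (suc a) (λ j → laplaceTerm (a ℕ.+ d) M (j ↑ˡ d)) + sumFin d (λ j → laplaceTerm (a ℕ.+ d) M (suc a ↑ʳ j))
    ≡⟨ cong₂ _+_ (sum-cong (suc a) left-columns) (sum-zero d right-columns) ⟩
  sumFin (suc a) (λ j → laplaceTerm a A j * det d D) + 0ℚ
    ≡⟨ +-identityʳ _ ⟩
  sumFin (suc a) (λ j → laplaceTerm a A j * det d D)
    ≡⟨ *-distribʳ-sum (suc a) (det d D) (laplaceTerm a A) ⟩
  det (suc a) A * det d D ∎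
  where
  open ≡-Reasoning
  A : Matrix (suc a)
  A i j = M (i ↑ˡ d) (j ↑ˡ d)
  D : Matrix d
  D i j = M (suc a ↑ʳ i) (suc a ↑ʳ j)
  right-columns : ∀ j → laplaceTerm (a ℕ.+ d) M (suc a ↑ʳ j) ≡ 0ℚ
  right-columns j =
    trans (cong (λ x → sign (toℕ (suc a ↑ʳ j)) * (x * det (a ℕ.+ d) (minor M (suc a ↑ʳ j)))) (upper≡0 zero j))
          (solve 2 (λ s y → s :* (con 0ℚ :* y) := con 0ℚ) refl (sign (toℕ (suc a ↑ʳ j))) (det (a ℕ.+ d) (minor M (suc a ↑ʳ j))))
  left-columns : ∀ j → laplaceTerm (a ℕ.+ d) M (j ↑ˡ d) ≡ laplaceTerm a A j * det d D
  left-columns j =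
    trans (cong₂ (λ s y → sign s * (A zero j * y)) (Finₚ.toℕ-↑ˡ j d)
            (trans (det-blockTriangular a d (minor M (j ↑ˡ d))
                      (λ i c → trans (cong (M (suc (i ↑ˡ d))) (punchIn-↑ʳ d j c)) (upper≡0 (suc i) c)))
                   (cong₂ _*_ (det-cong a (λ r c → cong (M (suc (r ↑ˡ d))) (punchIn-↑ˡ d j c)))
                              (det-cong d (λ r c → cong (M (suc (a ↑ʳ r))) (punchIn-↑ʳ d j c))))))
          (solve 4 (λ s x y z → s :* (x :* (y :* z)) := s :* (x :* y) :* z) refl
                 (sign (toℕ j)) (A zero j) (det a (minor A j)) (det d D))

det-scale : ∀ n (c : ℚ) (M : Matrix n) → det n (λ i j → c * M i j) ≡ (c ^ n) * det n M
det-scale zero    c M = sym (*-identityˡ 1ℚ)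
det-scale (suc n) c M =
  trans (sum-cong (suc n) (λ j →
          trans (cong (λ y → sign (toℕ j) * ((c * M zero j) * y)) (det-scale n c (minor M j)))
                (solve 5 (λ s c p m d → s :* ((c :* m) :* (p :* d)) := (c :* p) :* (s :* (m :* d))) refl
                       (sign (toℕ j)) c (c ^ n) (M zero j) (det n (minor M j)))))
        (*-distribˡ-sum (suc n) (c ^ suc n) (laplaceTerm n M))

det-zero-column : ∀ n (M : Matrix n) (k : Fin n) → (∀ i → M i k ≡ 0ℚ) → det n M ≡ 0ℚ
det-zero-column (suc n) M k column≡0 = sum-zero (suc n) vanishing
  where
  vanishing : ∀ j → laplaceTerm n M j ≡ 0ℚ
  vanishing j with j ≟ k
  ... | yes refl = trans (cong (λ x → sign (toℕ j) * (x * det n (minor M j))) (column≡0 zero))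
                         (solve 2 (λ s y → s :* (con 0ℚ :* y) := con 0ℚ) refl (sign (toℕ j)) (det n (minor M j)))
  ... | no j≢k   = trans (cong (λ y → sign (toℕ j) * (M zero j * y))
                           (det-zero-column n (minor M j) (punchOut j≢k)
                              (λ r → trans (cong (M (suc r)) (Finₚ.punchIn-punchOut j≢k)) (column≡0 (suc r)))))
                         (solve 2 (λ s x → s :* (x :* con 0ℚ) := con 0ℚ) refl (sign (toℕ j)) (M zero j))

det-column-corner : ∀ n (M : Matrix (suc n)) → (∀ r → M (suc r) zero ≡ 0ℚ) →
  det (suc n) M ≡ M zero zero * det n (λ r c → M (suc r) (suc c))
det-column-corner n M column≡0 =
  trans (cong (_+_ (laplaceTerm n M zero)) (sum-zero n other-columns))
        (trans (+-identityʳ _) (*-identityˡ _))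
  where
  other-columns : ∀ b → laplaceTerm n M (suc b) ≡ 0ℚ
  other-columns b =
    trans (cong (λ y → sign (toℕ (suc b)) * (M zero (suc b) * y)) (minor-vanishes M b column≡0))
          (solve 2 (λ s x → s :* (x :* con 0ℚ) := con 0ℚ) refl (sign (toℕ (suc b))) (M zero (suc b)))
    where
    minor-vanishes : ∀ {m} (N : Matrix (suc m)) b → (∀ r → N (suc r) zero ≡ 0ℚ) → det m (minor N (suc b)) ≡ 0ℚ
    minor-vanishes {suc m} N b N≡0 = det-zero-column (suc m) (minor N (suc b)) zero N≡0

-- Replacing the top row of the bordered matrix [[0, 0ᵀ], [-1, B]] by its row a + 1 gives two
-- equal rows, while its Laplace expansion is - det B + Σ_b B a b · y b for the cofactors y.
cofactors-solve : ∀ n (B : Matrix n) → Σ[ y ∈ (Fin n → ℚ) ] (∀ a → sumFin n (λ b → B a b * y b) ≡ det n B)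
cofactors-solve n B = y , solves
  where
  W : Matrix (suc n)
  W zero    _       = 0ℚ
  W (suc a) zero    = - 1ℚ
  W (suc a) (suc b) = B a b
  y : Fin n → ℚ
  y b = sign (toℕ (suc b)) * det n (minor W (suc b))
  repeated : Fin n → Matrix (suc n)
  repeated a = setRow W zero (W (suc a))
  vanishes : ∀ a → det (suc n) (repeated a) ≡ 0ℚ
  vanishes a = det-equal-rows (suc n) (repeated a) zero (suc a) (λ ())
    (λ j → trans (setRow-≡ W zero (W (suc a)) j) (sym (setRow-≢ W zero (W (suc a)) (suc a) j (λ ()))))
  expansion : ∀ a → det (suc n) (repeated a) ≡ - det n B + sumFin n (λ b → B a b * y b)
  expansion a =
    trans (sum-cong (suc n) {g = λ j → sign (toℕ j) * (W (suc a) j * det n (minor W j))}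
            (λ j → cong₂ (λ x d → sign (toℕ j) * (x * d)) (setRow-≡ W zero (W (suc a)) j)
                          (det-cong n (λ r c → setRow-≢ W zero (W (suc a)) (suc r) (punchIn j c) (λ ())))))
          (cong₂ _+_ (solve 1 (λ d → con 1ℚ :* ((:- con 1ℚ) :* d) := :- d) refl (det n B))
                     (sum-cong n (λ b → solve 3 (λ s x d → s :* (x :* d) := x :* (s :* d)) refl
                                             (sign (toℕ (suc b))) (B a b) (det n (minor W (suc b))))))
  solves : ∀ a → sumFin n (λ b → B a b * y b) ≡ det n B
  solves a =
    trans (solve 2 (λ d s → s := d :+ ((:- d) :+ s)) refl (det n B) (sumFin n (λ b → B a b * y b)))
          (trans (cong (det n B +_) (trans (sym (expansion a)) (vanishes a))) (+-identityʳ (det n B)))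

solve-ones : ∀ n (B : Matrix n) → det n B ≢ 0ℚ → Σ[ z ∈ (Fin n → ℚ) ] (∀ a → sumFin n (λ b → B a b * z b) ≡ 1ℚ)
solve-ones n B det≢0 = (λ b → y b * det⁻¹) , λ a → begin
  sumFin n (λ b → B a b * (y b * det⁻¹))  ≡⟨ sum-cong n (λ b → solve 3 (λ x y e → x :* (y :* e) := (x :* y) :* e) refl (B a b) (y b) det⁻¹) ⟩
  sumFin n (λ b → B a b * y b * det⁻¹)    ≡⟨ *-distribʳ-sum n det⁻¹ (λ b → B a b * y b) ⟩
  sumFin n (λ b → B a b * y b) * det⁻¹    ≡⟨ cong (_* det⁻¹) (proj₂ (cofactors-solve n B) a) ⟩
  det n B * det⁻¹                         ≡⟨ *-inverseʳ (det n B) {{≢-nonZero det≢0}} ⟩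
  1ℚ                                      ∎
  where
  open ≡-Reasoning
  y = proj₁ (cofactors-solve n B)
  det⁻¹ = (1/ det n B) {{≢-nonZero det≢0}}

bordered : ∀ {n} → Matrix n → Matrix (suc n)
bordered B zero    _       = 1ℚ
bordered B (suc a) zero    = - 1ℚ
bordered B (suc a) (suc b) = B a b

-- Adding row 0 to every other row clears the first column.
det-bordered-+-ones : ∀ n (B : Matrix n) → det (suc n) (bordered B) ≡ det n (λ a b → B a b + 1ℚ)
det-bordered-+-ones n B =
  trans (sym (det-add-source-rows (suc n) W add-top (λ { zero → true ; (suc _) → false })
                (λ { zero (suc s) _ → refl ; (suc i) (suc s) _ → refl }) (λ { zero s _ → refl })))
        (trans (det-cong (suc n) entries)
               (trans (det-column-corner n W₁ (λ r → refl)) (*-identityˡ _)))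
  where
  W = bordered B

  add-top : Fin (suc n) → Fin (suc n) → ℚ
  add-top (suc a) zero = 1ℚ
  add-top _       _    = 0ℚ

  W₁ : Matrix (suc n)
  W₁ zero    j       = W zero j
  W₁ (suc a) zero    = 0ℚ
  W₁ (suc a) (suc b) = B a b + 1ℚ

  sum-0* : ∀ j → sumFin n (λ s → 0ℚ * W (suc s) j) ≡ 0ℚ
  sum-0* j = sum-zero n (λ s → *-zeroˡ (W (suc s) j))

  entries : ∀ i j → W i j + sumFin (suc n) (λ s → add-top i s * W s j) ≡ W₁ i j
  entries zero    j       = trans (cong (λ x → 1ℚ + (0ℚ * 1ℚ + x)) (sum-0* j)) refl
  entries (suc a) zero    = trans (cong (λ x → - 1ℚ + (1ℚ * 1ℚ + x)) (sum-0* zero)) refl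
  entries (suc a) (suc b) = trans (cong (λ x → B a b + (1ℚ * 1ℚ + x)) (sum-0* (suc b)))
                                  (solve 1 (λ w → w :+ (con 1ℚ :* con 1ℚ :+ con 0ℚ) := w :+ con 1ℚ) refl (B a b))

-- Subtracting Σ_a z a · (row a + 1) from row 0 clears the first row.
det-bordered : ∀ n (B : Matrix n) (z : Fin n → ℚ) → (∀ b → sumFin n (λ a → z a * B a b) ≡ 1ℚ) →
  det (suc n) (bordered B) ≡ (1ℚ + sumFin n z) * det n B
det-bordered n B z zB≡1 =
  trans (sym (det-add-source-rows (suc n) W subtract-z (λ { zero → false ; (suc _) → true })
                (λ { zero zero _ → refl ; (suc i) zero _ → refl }) (λ { (suc i) s _ → refl })))
        (trans (det-cong (suc n) entries)
               (trans (det-blockTriangular 1 n W₂ (λ { zero j → refl }))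
                      (cong (_* det n B) (solve 1 (λ x → con 1ℚ :* (x :* con 1ℚ) :+ con 0ℚ := x) refl (1ℚ + sumFin n z)))))
  where
  W = bordered B

  subtract-z : Fin (suc n) → Fin (suc n) → ℚ
  subtract-z zero (suc a) = - z a
  subtract-z _    _       = 0ℚ

  W₂ : Matrix (suc n)
  W₂ zero    zero    = 1ℚ + sumFin n z
  W₂ zero    (suc b) = 0ℚ
  W₂ (suc a) j       = W (suc a) j

  entries : ∀ i j → W i j + sumFin (suc n) (λ s → subtract-z i s * W s j) ≡ W₂ i j
  entries zero zero =
    trans (cong (λ x → 1ℚ + (0ℚ * 1ℚ + x)) (sum-cong n (λ a → solve 1 (λ x → (:- x) :* (:- con 1ℚ) := x) refl (z a))))
          (cong (1ℚ +_) (+-identityˡ (sumFin n z)))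
  entries zero (suc b) =
    trans (cong (λ x → 1ℚ + (0ℚ * 1ℚ + x))
                (trans (sum-cong n (λ a → solve 2 (λ x y → (:- x) :* y := :- (x :* y)) refl (z a) (B a b)))
                       (trans (neg-distrib-sum n (λ a → z a * B a b)) (cong -_ (zB≡1 b)))))
          refl
  entries (suc a) j = trans (cong (W (suc a) j +_) (sum-zero (suc n) (λ s → *-zeroˡ (W s j)))) (+-identityʳ _)

det-+-ones : ∀ n (B : Matrix n) (z : Fin n → ℚ) → (∀ b → sumFin n (λ a → z a * B a b) ≡ 1ℚ) →
  det n (λ a b → B a b + 1ℚ) ≡ (1ℚ + sumFin n z) * det n B
det-+-ones n B z zB≡1 = trans (sym (det-bordered-+-ones n B)) (det-bordered n B z zB≡1)

diagonalBlocks : ∀ {m k} → Matrix k → Fin k × Fin m → Fin k × Fin m → ℚ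
diagonalBlocks B (a , i) (b , j) = if ⌊ i ≟ j ⌋ then B a b else 0ℚ

-- I_m ⊗ B: the index x stands for row a of the i-th block, where quotRem x = (a , i).
blockDiagonal : ∀ m {k} → Matrix k → Matrix (m ℕ.* k)
blockDiagonal m {k} B x y = diagonalBlocks B (quotRem {m} k x) (quotRem {m} k y)

diagonalBlocks-same : ∀ {m k} (B : Matrix k) a b (i : Fin m) → diagonalBlocks B (a , i) (b , i) ≡ B a b
diagonalBlocks-same B a b i rewrite ⌊⌋-yes (i ≟ i) refl = refl

diagonalBlocks-other : ∀ {m k} (B : Matrix k) a b (i j : Fin m) → i ≢ j → diagonalBlocks B (a , i) (b , j) ≡ 0ℚ
diagonalBlocks-other B a b i j i≢j rewrite ⌊⌋-no (i ≟ j) i≢j = refl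

det-blockDiagonal : ∀ m k (B : Matrix k) → det (m ℕ.* k) (blockDiagonal m B) ≡ det k B ^ m
det-blockDiagonal zero    k B = refl
det-blockDiagonal (suc m) k B =
  trans (det-blockTriangular k (m ℕ.* k) (blockDiagonal (suc m) B)
          (λ i j → cong₂ (diagonalBlocks B) (quotRem-↑ˡ m k i) (quotRem-↑ʳ m k j)))
        (cong₂ _*_ (det-cong k (λ i j → trans (cong₂ (diagonalBlocks B) (quotRem-↑ˡ m k i) (quotRem-↑ˡ m k j))
                                              (diagonalBlocks-same {suc m} B i j zero)))
                   (trans (det-cong (m ℕ.* k) (λ x y → trans (cong₂ (diagonalBlocks B) (quotRem-↑ʳ m k x) (quotRem-↑ʳ m k y))
                                                            (shift (quotRem {m} k x) (quotRem {m} k y))))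
                          (det-blockDiagonal m k B)))
  where
  shift : ∀ p q → diagonalBlocks {suc m} B (map₂ suc p) (map₂ suc q) ≡ diagonalBlocks {m} B p q
  shift (a , i) (b , j) with i ≟ j
  ... | yes _ = refl
  ... | no _  = refl

-- Adding Σ_(a,i) R u i · z a · (row (a , i)) to each top row u clears the top-right block
-- (because zᵀB = 1ᵀ) and replaces the top-left block T by T - Γ R Rᵀ with Γ = Σ z.
module _ (n m k : ℕ) (X : Matrix (n ℕ.+ m ℕ.* k)) (R : Fin n → Fin m → ℚ)
         (B : Matrix k) (z : Fin k → ℚ) (zB≡1 : ∀ b → sumFin k (λ a → z a * B a b) ≡ 1ℚ)
         (X-top-right : ∀ u y → X (u ↑ˡ m ℕ.* k) (n ↑ʳ y) ≡ - R u (proj₂ (quotRem {m} k y)))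
         (X-bottom-left : ∀ x v → X (n ↑ʳ x) (v ↑ˡ m ℕ.* k) ≡ - R v (proj₂ (quotRem {m} k x)))
         (X-bottom-right : ∀ x y → X (n ↑ʳ x) (n ↑ʳ y) ≡ blockDiagonal m B x y) where

  private
    N = n ℕ.+ m ℕ.* k
    Γ = sumFin k z

    top : Fin n → Fin N
    top u = u ↑ˡ m ℕ.* k

    bottom : Fin (m ℕ.* k) → Fin N
    bottom x = n ↑ʳ x

    blockCoefficient : Fin n ⊎ Fin (m ℕ.* k) → Fin n ⊎ Fin (m ℕ.* k) → ℚ
    blockCoefficient (inj₁ u) (inj₂ y) = R u (proj₂ (quotRem {m} k y)) * z (proj₁ (quotRem {m} k y))
    blockCoefficient _        _        = 0ℚ

    coefficient : Fin N → Fin N → ℚ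
    coefficient x s = blockCoefficient (splitAt n x) (splitAt n s)

    isBottom : Fin N → Bool
    isBottom s with splitAt n s
    ... | inj₁ _ = false
    ... | inj₂ _ = true

    from-bottom : ∀ i s → isBottom s ≡ false → coefficient i s ≡ 0ℚ
    from-bottom i s _ with splitAt n i | splitAt n s
    from-bottom i s () | _      | inj₂ _
    ... | inj₁ _ | inj₁ _ = refl
    ... | inj₂ _ | inj₁ _ = refl

    into-top : ∀ i s → isBottom i ≡ true → coefficient i s ≡ 0ℚ
    into-top i s _ with splitAt n i | splitAt n s
    into-top i s () | inj₁ _ | _
    ... | inj₂ _ | inj₁ _ = refl
    ... | inj₂ _ | inj₂ _ = refl

    X' : Matrix N
    X' i j = X i j + sumFin N (λ s → coefficient i s * X s j)

    coefficient-top-top : ∀ u v → coefficient (top u) (top v) ≡ 0ℚ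
    coefficient-top-top u v rewrite Finₚ.splitAt-↑ˡ n u (m ℕ.* k) | Finₚ.splitAt-↑ˡ n v (m ℕ.* k) = refl

    coefficient-top-bottom : ∀ u y → coefficient (top u) (bottom y) ≡ R u (proj₂ (quotRem {m} k y)) * z (proj₁ (quotRem {m} k y))
    coefficient-top-bottom u y rewrite Finₚ.splitAt-↑ˡ n u (m ℕ.* k) | Finₚ.splitAt-↑ʳ n (m ℕ.* k) y = refl

    coefficient-bottom : ∀ x s → coefficient (bottom x) s ≡ 0ℚ
    coefficient-bottom x s rewrite Finₚ.splitAt-↑ʳ n (m ℕ.* k) x with splitAt n s
    ... | inj₁ _ = refl
    ... | inj₂ _ = refl

    added-to-top : ∀ u j (F : Fin k → Fin m → ℚ) → (∀ y → X (bottom y) j ≡ uncurry F (quotRem {m} k y)) →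
      sumFin N (λ s → coefficient (top u) s * X s j) ≡ sumFin m (λ i → sumFin k (λ a → R u i * z a * F a i))
    added-to-top u j F X≡F =
      trans (sum-splitAt n (m ℕ.* k) (λ s → coefficient (top u) s * X s j))
            (trans (cong₂ _+_ (sum-zero n (λ v → trans (cong (_* X (top v) j) (coefficient-top-top u v)) (*-zeroˡ (X (top v) j))))
                              (sum-quotRem m k _ (λ a i → R u i * z a * F a i) (λ y → cong₂ _*_ (coefficient-top-bottom u y) (X≡F y))))
                   (+-identityˡ _))

    X'-top-right : ∀ u y → X' (top u) (bottom y) ≡ 0ℚ
    X'-top-right u y = begin
      X (top u) (bottom y) + sumFin N (λ s → coefficient (top u) s * X s (bottom y))
        ≡⟨ cong₂ _+_ (X-top-right u y) (added-to-top u (bottom y) (λ a i → diagonalBlocks B (a , i) (b , i₀)) (λ x → X-bottom-right x y)) ⟩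
      - R u i₀ + sumFin m (λ i → sumFin k (λ a → R u i * z a * diagonalBlocks B (a , i) (b , i₀)))
        ≡⟨ cong (- R u i₀ +_) (sum-single m i₀ _ (λ i i≢i₀ → sum-zero k (λ a →
             trans (cong (R u i * z a *_) (diagonalBlocks-other B a b i i₀ i≢i₀)) (*-zeroʳ (R u i * z a))))) ⟩
      - R u i₀ + sumFin k (λ a → R u i₀ * z a * diagonalBlocks B (a , i₀) (b , i₀))
        ≡⟨ cong (- R u i₀ +_) (sum-cong k (λ a → trans (cong (R u i₀ * z a *_) (diagonalBlocks-same B a b i₀))
             (solve 3 (λ r x b → r :* x :* b := r :* (x :* b)) refl (R u i₀) (z a) (B a b)))) ⟩
      - R u i₀ + sumFin k (λ a → R u i₀ * (z a * B a b))
        ≡⟨ cong (- R u i₀ +_) (trans (*-distribˡ-sum k (R u i₀) (λ a → z a * B a b)) (cong (R u i₀ *_) (zB≡1 b))) ⟩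
      - R u i₀ + R u i₀ * 1ℚ
        ≡⟨ solve 1 (λ r → :- r :+ r :* con 1ℚ := con 0ℚ) refl (R u i₀) ⟩
      0ℚ ∎
      where
      open ≡-Reasoning
      b = proj₁ (quotRem {m} k y)
      i₀ = proj₂ (quotRem {m} k y)

    X'-top-left : ∀ u v → X' (top u) (top v) ≡ X (top u) (top v) - Γ * sumFin m (λ i → R u i * R v i)
    X'-top-left u v =
      trans (cong (X (top u) (top v) +_) (added-to-top u (top v) (λ a i → - R v i) (λ y → X-bottom-left y v)))
            (cong (X (top u) (top v) +_) (begin
              sumFin m (λ i → sumFin k (λ a → R u i * z a * - R v i))
                ≡⟨ sum-cong m (λ i → trans (sum-cong k (λ a → solve 3 (λ r x s → r :* x :* (:- s) := :- (r :* s) :* x) refl (R u i) (z a) (R v i)))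
                                           (*-distribˡ-sum k (- (R u i * R v i)) z)) ⟩
              sumFin m (λ i → - (R u i * R v i) * Γ)
                ≡⟨ *-distribʳ-sum m Γ (λ i → - (R u i * R v i)) ⟩
              sumFin m (λ i → - (R u i * R v i)) * Γ
                ≡⟨ cong (_* Γ) (neg-distrib-sum m (λ i → R u i * R v i)) ⟩
              - sumFin m (λ i → R u i * R v i) * Γ
                ≡⟨ solve 2 (λ s g → (:- s) :* g := :- (g :* s)) refl (sumFin m (λ i → R u i * R v i)) Γ ⟩
              - (Γ * sumFin m (λ i → R u i * R v i)) ∎))
      where open ≡-Reasoning

    X'-bottom : ∀ x j → X' (bottom x) j ≡ X (bottom x) j
    X'-bottom x j = trans (cong (X (bottom x) j +_) (sum-zero N (λ s → trans (cong (_* X s j) (coefficient-bottom x s)) (*-zeroˡ (X s j)))))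
                          (+-identityʳ _)

  det-schur-complement :
    det (n ℕ.+ m ℕ.* k) X
      ≡ det n (λ u v → X (u ↑ˡ m ℕ.* k) (v ↑ˡ m ℕ.* k) - sumFin k z * sumFin m (λ i → R u i * R v i)) * det k B ^ m
  det-schur-complement =
    trans (sym (det-add-source-rows N X coefficient isBottom from-bottom into-top))
          (trans (det-blockTriangular n (m ℕ.* k) X' X'-top-right)
                 (cong₂ _*_ (det-cong n X'-top-left)
                            (trans (det-cong (m ℕ.* k) (λ x y → trans (X'-bottom x (bottom y)) (X-bottom-right x y)))
                                   (det-blockDiagonal m k B))))

-- Incidence matrices

δ : ∀ {n} → Fin n → Fin n → ℚ
δ u i = bool→ℚ ⌊ u ≟ i ⌋

δ-≡ : ∀ {n} (u : Fin n) → δ u u ≡ 1ℚ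
δ-≡ u = cong bool→ℚ (⌊⌋-yes (u ≟ u) refl)

δ-≢ : ∀ {n} (u i : Fin n) → u ≢ i → δ u i ≡ 0ℚ
δ-≢ u i u≢i = cong bool→ℚ (⌊⌋-no (u ≟ i) u≢i)

δ-sym : ∀ {n} (u i : Fin n) → δ u i ≡ δ i u
δ-sym u i with u ≟ i
... | yes refl = sym (δ-≡ u)
... | no u≢i   = sym (δ-≢ i u (u≢i ∘ sym))

sum-δ : ∀ n (u : Fin n) (F : Fin n → ℚ) → sumFin n (λ i → δ u i * F i) ≡ F u
sum-δ n u F =
  trans (sum-single n u _ (λ i i≢u → trans (cong (_* F i) (δ-≢ u i (i≢u ∘ sym))) (*-zeroˡ (F i))))
        (trans (cong (_* F u) (δ-≡ u)) (*-identityˡ (F u)))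

sum-δ-row : ∀ n (u : Fin n) (H : Matrix n) → sumFin n (λ i → sumFin n (λ j → H i j * δ u i)) ≡ sumFin n (H u)
sum-δ-row n u H =
  trans (sum-cong n (λ i → trans (*-distribʳ-sum n (δ u i) (H i)) (*-comm _ (δ u i))))
        (sum-δ n u (λ i → sumFin n (H i)))

sum-δ-column : ∀ n (u : Fin n) (H : Matrix n) → sumFin n (λ i → sumFin n (λ j → H i j * δ u j)) ≡ sumFin n (λ i → H i u)
sum-δ-column n u H =
  sum-cong n (λ i → trans (sum-cong n (λ j → *-comm (H i j) (δ u j))) (sum-δ n u (H i)))

sum-δ-δ : ∀ n (u v : Fin n) (H : Matrix n) → sumFin n (λ i → sumFin n (λ j → H i j * (δ u i * δ v j))) ≡ H u v
sum-δ-δ n u v H =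
  trans (sum-cong n (λ i → sum-cong n (λ j → solve 3 (λ h a b → h :* (a :* b) := h :* b :* a) refl (H i j) (δ u i) (δ v j))))
        (trans (sum-δ-row n u (λ i j → H i j * δ v j))
               (trans (sum-cong n (λ j → *-comm (H u j) (δ v j))) (sum-δ n v (H u))))

listSum : ∀ {A : Set} → (A → ℚ) → List A → ℚ
listSum g []       = 0ℚ
listSum g (x ∷ xs) = g x + listSum g xs

sum-lookup : ∀ {A : Set} (g : A → ℚ) (xs : List A) → sumFin (length xs) (g ∘ lookup xs) ≡ listSum g xs
sum-lookup g []       = refl
sum-lookup g (x ∷ xs) = cong (g x +_) (sum-lookup g xs)

listSum-++ : ∀ {A : Set} (g : A → ℚ) (xs ys : List A) → listSum g (xs ++ ys) ≡ listSum g xs + listSum g ys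
listSum-++ g []       ys = sym (+-identityˡ _)
listSum-++ g (x ∷ xs) ys =
  trans (cong (g x +_) (listSum-++ g xs ys))
        (solve 3 (λ a b c → a :+ (b :+ c) := (a :+ b) :+ c) refl (g x) (listSum g xs) (listSum g ys))

listSum-concatMap : ∀ {A B : Set} (g : B → ℚ) (f : A → List B) (xs : List A) →
  listSum g (concatMap f xs) ≡ listSum (listSum g ∘ f) xs
listSum-concatMap g f []       = refl
listSum-concatMap g f (x ∷ xs) =
  trans (listSum-++ g (f x) (concatMap f xs)) (cong (listSum g (f x) +_) (listSum-concatMap g f xs))

listSum-tabulate : ∀ {A : Set} n (h : A → ℚ) (f : Fin n → A) → listSum h (tabulate f) ≡ sumFin n (h ∘ f)
listSum-tabulate zero    h f = refl
listSum-tabulate (suc n) h f = cong (h (f zero) +_) (listSum-tabulate n h (f ∘ suc))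

listSum-if : ∀ {A : Set} (g : A → ℚ) (b : Bool) (x : A) → listSum g (if b then x ∷ [] else []) ≡ bool→ℚ b * g x
listSum-if g true  x = trans (+-identityʳ (g x)) (sym (*-identityˡ (g x)))
listSum-if g false x = sym (*-zeroˡ (g x))

module _ {n : ℕ} (G : SimpleGraph n) where

  -- The adjacency matrix restricted to i < j, i.e. the edges in the order listed by `edges`.
  upperAdjacency : Matrix n
  upperAdjacency i j = bool→ℚ (⌊ i <? j ⌋ ∧ adj G i j)

  sum-edges : ∀ (g : Fin n × Fin n → ℚ) →
    sumFin (numEdges G) (g ∘ lookup (edges G)) ≡ sumFin n (λ i → sumFin n (λ j → upperAdjacency i j * g (i , j)))
  sum-edges g =
    trans (sum-lookup g (edges G))
    (trans (listSum-concatMap g _ (allFin n))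
    (trans (listSum-tabulate n _ id)
           (sum-cong n (λ i → trans (listSum-concatMap g _ (allFin n))
                              (trans (listSum-tabulate n _ id)
                                     (sum-cong n (λ j → listSum-if g (⌊ i <? j ⌋ ∧ adj G i j) (i , j))))))))

  upperAdjacency-diagonal : ∀ u → upperAdjacency u u ≡ 0ℚ
  upperAdjacency-diagonal u rewrite ⌊⌋-no (u <? u) (Finₚ.<-irrefl refl) = refl

  upperAdjacency-symmetrize : ∀ u v → upperAdjacency u v + upperAdjacency v u ≡ bool→ℚ (adj G u v)
  upperAdjacency-symmetrize u v with u <? v | v <? u
  ... | yes u<v | yes v<u = ⊥-elim (Finₚ.<-asym u<v v<u)
  ... | yes _   | no _    = +-identityʳ _
  ... | no _    | yes _   = trans (+-identityˡ _) (cong bool→ℚ (SimpleGraph.sym G v u))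
  ... | no u≮v  | no v≮u with Finₚ.<-cmp u v
  ...   | tri< u<v _ _   = ⊥-elim (u≮v u<v)
  ...   | tri> _ _ v<u   = ⊥-elim (v≮u v<u)
  ...   | tri≈ _ refl _  = cong bool→ℚ (sym (irrefl G u))

  edge-endpoints-distinct : ∀ k → proj₁ (lookup (edges G) k) ≢ proj₂ (lookup (edges G) k)
  edge-endpoints-distinct k =
    All.lookup (concat⁺ (map⁺ (All.universal (λ i → concat⁺ (map⁺ (All.universal (proper i) (allFin n)))) (allFin n))))
               (∈-lookup k)
    where
    proper : ∀ i j → All (λ e → proj₁ e ≢ proj₂ e) (if ⌊ i <? j ⌋ ∧ adj G i j then (i , j) ∷ [] else [])
    proper i j with i <? j
    ... | no _    = []
    ... | yes i<j with adj G i j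
    ...   | true  = (λ i≡j → Finₚ.<-irrefl i≡j i<j) ∷ []
    ...   | false = []

incidence : ∀ {n} → Fin n → Fin n × Fin n → ℚ
incidence u e = bool→ℚ (isEndpoint u e)

incidence-idempotent : ∀ {n} (u : Fin n) e → incidence u e * incidence u e ≡ incidence u e
incidence-idempotent u e with isEndpoint u e
... | true  = refl
... | false = refl

incidence-proper : ∀ {n} (u i j : Fin n) → i ≢ j → incidence u (i , j) ≡ δ u i + δ u j
incidence-proper u i j i≢j with u ≟ i | u ≟ j
... | yes refl | yes refl = ⊥-elim (i≢j refl)
... | yes _    | no _     = refl
... | no _     | yes _    = refl
... | no _     | no _     = refl

incidence-product : ∀ {n} (u v : Fin n) → u ≢ v → ∀ i j →
  incidence u (i , j) * incidence v (i , j) ≡ δ u i * δ v j + δ u j * δ v i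
incidence-product u v u≢v i j with u ≟ i | u ≟ j | v ≟ i | v ≟ j
... | yes refl | _      | yes refl | _      = ⊥-elim (u≢v refl)
... | _      | yes refl | _      | yes refl = ⊥-elim (u≢v refl)
... | yes _  | yes _    | no _   | no _     = refl
... | yes _  | no _     | no _   | yes _    = refl
... | yes _  | no _     | no _   | no _     = refl
... | no _   | yes _    | yes _  | no _     = refl
... | no _   | yes _    | no _   | no _     = refl
... | no _   | no _     | yes _  | yes _    = refl
... | no _   | no _     | yes _  | no _     = refl
... | no _   | no _     | no _   | yes _    = refl
... | no _   | no _     | no _   | no _     = refl

sum-incidence : ∀ n (i j : Fin n) → i ≢ j → sumFin n (λ w → incidence w (i , j)) ≡ 1ℚ + 1ℚ
sum-incidence n i j i≢j =
  trans (sum-cong n (λ w → incidence-proper w i j i≢j))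
        (trans (sum-distrib-+ n (λ w → δ w i) (λ w → δ w j)) (cong₂ _+_ (column-sum i) (column-sum j)))
  where
  column-sum : ∀ r → sumFin n (λ w → δ w r) ≡ 1ℚ
  column-sum r = trans (sum-cong n (λ w → trans (δ-sym w r) (sym (*-identityʳ (δ r w))))) (sum-δ n r (λ _ → 1ℚ))

degreeℚ : ∀ {n} → (Fin n → Fin n → Bool) → Fin n → ℚ
degreeℚ {n} a i = sumFin n (λ j → bool→ℚ (a i j))

module _ {n : ℕ} (G : SimpleGraph n) where

  private
    H = upperAdjacency G

  incidenceMatrix : Fin n → Fin (numEdges G) → ℚ
  incidenceMatrix u k = incidence u (lookup (edges G) k)

  incidence-gram-≢ : ∀ u v → u ≢ v →
    sumFin (numEdges G) (λ k → incidenceMatrix u k * incidenceMatrix v k) ≡ bool→ℚ (adj G u v)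
  incidence-gram-≢ u v u≢v = begin
    sumFin (numEdges G) (λ k → incidenceMatrix u k * incidenceMatrix v k)
      ≡⟨ sum-edges G (λ e → incidence u e * incidence v e) ⟩
    sumFin n (λ i → sumFin n (λ j → H i j * (incidence u (i , j) * incidence v (i , j))))
      ≡⟨ sum-cong n (λ i → trans (sum-cong n (λ j → split i j)) (sum-distrib-+ n _ _)) ⟩
    sumFin n (λ i → sumFin n (λ j → H i j * (δ u i * δ v j)) + sumFin n (λ j → H i j * (δ v i * δ u j)))
      ≡⟨ sum-distrib-+ n _ _ ⟩
    sumFin n (λ i → sumFin n (λ j → H i j * (δ u i * δ v j))) + sumFin n (λ i → sumFin n (λ j → H i j * (δ v i * δ u j)))
      ≡⟨ cong₂ _+_ (sum-δ-δ n u v H) (sum-δ-δ n v u H) ⟩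
    H u v + H v u
      ≡⟨ upperAdjacency-symmetrize G u v ⟩
    bool→ℚ (adj G u v) ∎
    where
    open ≡-Reasoning
    split : ∀ i j → H i j * (incidence u (i , j) * incidence v (i , j)) ≡ H i j * (δ u i * δ v j) + H i j * (δ v i * δ u j)
    split i j = trans (cong (H i j *_) (incidence-product u v u≢v i j))
                      (solve 5 (λ h a b c d → h :* (a :* b :+ c :* d) := h :* (a :* b) :+ h :* (d :* c)) refl
                             (H i j) (δ u i) (δ v j) (δ u j) (δ v i))

  incidence-degree : ∀ u → sumFin (numEdges G) (incidenceMatrix u) ≡ degreeℚ (adj G) u
  incidence-degree u = begin
    sumFin (numEdges G) (incidenceMatrix u)
      ≡⟨ sum-edges G (incidence u) ⟩
    sumFin n (λ i → sumFin n (λ j → H i j * incidence u (i , j)))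
      ≡⟨ sum-cong n (λ i → trans (sum-cong n (split i)) (sum-distrib-+ n _ _)) ⟩
    sumFin n (λ i → sumFin n (λ j → H i j * δ u i) + sumFin n (λ j → H i j * δ u j))
      ≡⟨ sum-distrib-+ n _ _ ⟩
    sumFin n (λ i → sumFin n (λ j → H i j * δ u i)) + sumFin n (λ i → sumFin n (λ j → H i j * δ u j))
      ≡⟨ cong₂ _+_ (sum-δ-row n u H) (sum-δ-column n u H) ⟩
    sumFin n (H u) + sumFin n (λ j → H j u)
      ≡⟨ sym (sum-distrib-+ n (H u) (λ j → H j u)) ⟩
    sumFin n (λ j → H u j + H j u)
      ≡⟨ sum-cong n (upperAdjacency-symmetrize G u) ⟩
    degreeℚ (adj G) u ∎
    where
    open ≡-Reasoning
    split : ∀ i j → H i j * incidence u (i , j) ≡ H i j * δ u i + H i j * δ u j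
    split i j with i ≟ j
    ... | yes refl rewrite upperAdjacency-diagonal G i =
      solve 2 (λ a b → con 0ℚ :* a := con 0ℚ :* b :+ con 0ℚ :* b) refl (incidence u (i , i)) (δ u i)
    ... | no i≢j = trans (cong (H i j *_) (incidence-proper u i j i≢j))
                         (solve 3 (λ h a b → h :* (a :+ b) := h :* a :+ h :* b) refl (H i j) (δ u i) (δ u j))

  incidence-gram-≡ : ∀ u → sumFin (numEdges G) (λ k → incidenceMatrix u k * incidenceMatrix u k) ≡ degreeℚ (adj G) u
  incidence-gram-≡ u = trans (sum-cong (numEdges G) (λ k → incidence-idempotent u (lookup (edges G) k))) (incidence-degree u)

-- Characteristic matrices and the edge corona

ℕtoℚ-if : ∀ b → ℕtoℚ (if b then 1 else 0) ≡ bool→ℚ b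
ℕtoℚ-if true  = refl
ℕtoℚ-if false = refl

degreeA≡degreeℚ : ∀ n (a : Fin n → Fin n → Bool) (i : Fin n) → ℕtoℚ (degreeA a i) ≡ degreeℚ a i
degreeA≡degreeℚ (suc zero)    a i = trans (ℕtoℚ-+ (if a i zero then 1 else 0) 0) (cong (_+ 0ℚ) (ℕtoℚ-if (a i zero)))
degreeA≡degreeℚ (suc (suc n)) a i =
  trans (ℕtoℚ-+ (if a i zero then 1 else 0) _)
        (cong₂ _+_ (ℕtoℚ-if (a i zero)) (degreeA≡degreeℚ (suc n) (λ _ j → a i (suc j)) zero))

charMatrix : ∀ {n} → (Fin n → Fin n → Bool) → ℚ → Matrix n
charMatrix a x i j = (if ⌊ i ≟ j ⌋ then x else 0ℚ) - signlessQ a i j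

charMatrix-diagonal : ∀ {n} (a : Fin n → Fin n → Bool) x i → charMatrix a x i i ≡ x - (degreeℚ a i + bool→ℚ (a i i))
charMatrix-diagonal {n} a x i with i ≟ i
... | yes _  = cong (λ d → x - (d + bool→ℚ (a i i))) (degreeA≡degreeℚ n a i)
... | no i≢i = ⊥-elim (i≢i refl)

charMatrix-off : ∀ {n} (a : Fin n → Fin n → Bool) x i j → i ≢ j → charMatrix a x i j ≡ - bool→ℚ (a i j)
charMatrix-off a x i j i≢j with i ≟ j
... | yes i≡j = ⊥-elim (i≢j i≡j)
... | no _    = +-identityˡ _

charMatrix-simple-diagonal : ∀ {n} (G : SimpleGraph n) x i → charMatrix (adj G) x i i ≡ x - degreeℚ (adj G) i
charMatrix-simple-diagonal G x i =
  trans (charMatrix-diagonal (adj G) x i)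
        (trans (cong (λ b → x - (degreeℚ (adj G) i + bool→ℚ b)) (irrefl G i))
               (solve 2 (λ x d → x :- (d :+ con 0ℚ) := x :- d) refl x (degreeℚ (adj G) i)))

charMatrix-symmetric : ∀ {n} (G : SimpleGraph n) x p q → charMatrix (adj G) x p q ≡ charMatrix (adj G) x q p
charMatrix-symmetric G x p q = by-cases (p ≟ q)
  where
  by-cases : Dec (p ≡ q) → charMatrix (adj G) x p q ≡ charMatrix (adj G) x q p
  by-cases (yes p≡q) = subst (λ r → charMatrix (adj G) x p r ≡ charMatrix (adj G) x r p) p≡q refl
  by-cases (no p≢q)  = trans (charMatrix-off (adj G) x p q p≢q)
                             (trans (cong (λ b → - bool→ℚ b) (SimpleGraph.sym G p q))
                                    (sym (charMatrix-off (adj G) x q p (p≢q ∘ sym))))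

module _ {n : ℕ} (G : SimpleGraph n) where

  complAdj-entry : ∀ p q → bool→ℚ (complAdj G p q) ≡ 1ℚ - δ p q - bool→ℚ (adj G p q)
  complAdj-entry p q = by-cases (p ≟ q)
    where
    by-cases : Dec (p ≡ q) → bool→ℚ (complAdj G p q) ≡ 1ℚ - δ p q - bool→ℚ (adj G p q)
    by-cases (yes refl) rewrite ⌊⌋-yes (p ≟ p) refl | irrefl G p = refl
    by-cases (no p≢q) rewrite ⌊⌋-no (p ≟ q) p≢q with adj G p q
    ... | true  = refl
    ... | false = refl

  complAdj-degree : ∀ p → degreeℚ (complAdj G) p ≡ ℕtoℚ n - 1ℚ - degreeℚ (adj G) p
  complAdj-degree p = begin
    sumFin n (λ q → bool→ℚ (complAdj G p q))
      ≡⟨ sum-cong n (λ q → trans (complAdj-entry p q)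
           (solve 2 (λ d b → con 1ℚ :- d :- b := con 1ℚ :+ (:- (d :* con 1ℚ) :+ :- b)) refl (δ p q) (bool→ℚ (adj G p q)))) ⟩
    sumFin n (λ q → 1ℚ + (- (δ p q * 1ℚ) + - bool→ℚ (adj G p q)))
      ≡⟨ trans (sum-distrib-+ n _ _) (cong (sumFin n (λ _ → 1ℚ) +_) (sum-distrib-+ n _ _)) ⟩
    sumFin n (λ _ → 1ℚ) + (sumFin n (λ q → - (δ p q * 1ℚ)) + sumFin n (λ q → - bool→ℚ (adj G p q)))
      ≡⟨ cong₂ (λ x y → x + (y + sumFin n (λ q → - bool→ℚ (adj G p q))))
               (sum-const n 1ℚ) (trans (neg-distrib-sum n (λ q → δ p q * 1ℚ)) (cong -_ (sum-δ n p (λ _ → 1ℚ)))) ⟩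
    ℕtoℚ n * 1ℚ + (- 1ℚ + sumFin n (λ q → - bool→ℚ (adj G p q)))
      ≡⟨ cong (λ y → ℕtoℚ n * 1ℚ + (- 1ℚ + y)) (neg-distrib-sum n (λ q → bool→ℚ (adj G p q))) ⟩
    ℕtoℚ n * 1ℚ + (- 1ℚ + - degreeℚ (adj G) p)
      ≡⟨ solve 2 (λ c d → c :* con 1ℚ :+ (:- con 1ℚ :+ :- d) := c :- con 1ℚ :- d) refl (ℕtoℚ n) (degreeℚ (adj G) p) ⟩
    ℕtoℚ n - 1ℚ - degreeℚ (adj G) p ∎
    where open ≡-Reasoning

  -- Q(Ḡ) = (n - 2) I - Q(G) + J, so (n - x) I - Q(Ḡ) = - ((x - 2) I - Q(G) + J).
  charMatrix-complement : ∀ x p q →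
    charMatrix (complAdj G) (ℕtoℚ n - x) p q ≡ (- 1ℚ) * (charMatrix (adj G) (x - ℕtoℚ 2) p q + 1ℚ)
  charMatrix-complement x p q = by-cases (p ≟ q)
    where
    by-cases : Dec (p ≡ q) → charMatrix (complAdj G) (ℕtoℚ n - x) p q ≡ (- 1ℚ) * (charMatrix (adj G) (x - ℕtoℚ 2) p q + 1ℚ)
    by-cases (yes refl) =
      trans (charMatrix-diagonal (complAdj G) _ p)
      (trans (cong₂ (λ d b → ℕtoℚ n - x - (d + bool→ℚ b)) (complAdj-degree p)
                    (cong (λ t → not t ∧ not (adj G p p)) (⌊⌋-yes (p ≟ p) refl)))
      (trans (solve 3 (λ c l d → c :- l :- (c :- con 1ℚ :- d :+ con 0ℚ) := (:- con 1ℚ) :* ((l :- (con 1ℚ :+ con 1ℚ)) :- d :+ con 1ℚ))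
                      refl (ℕtoℚ n) x (degreeℚ (adj G) p))
             (cong (λ t → (- 1ℚ) * (t + 1ℚ)) (sym (charMatrix-simple-diagonal G (x - ℕtoℚ 2) p)))))
    by-cases (no p≢q) =
      trans (charMatrix-off (complAdj G) _ p q p≢q)
      (trans (cong -_ (trans (complAdj-entry p q) (cong (λ d → 1ℚ - d - bool→ℚ (adj G p q)) (δ-≢ p q p≢q))))
      (trans (solve 1 (λ b → :- (con 1ℚ :- con 0ℚ :- b) := (:- con 1ℚ) :* (:- b :+ con 1ℚ)) refl (bool→ℚ (adj G p q)))
             (cong (λ t → (- 1ℚ) * (t + 1ℚ)) (sym (charMatrix-off (adj G) _ p q p≢q)))))

module _ {n1 n2 : ℕ} (G1 : SimpleGraph n1) (G2 : SimpleGraph n2) where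

  private
    m = numEdges G1
    a = edgeCoronaAdj G1 G2

    top : Fin n1 → Fin (n1 ℕ.+ m ℕ.* n2)
    top u = u ↑ˡ m ℕ.* n2

    bottom : Fin (m ℕ.* n2) → Fin (n1 ℕ.+ m ℕ.* n2)
    bottom x = n1 ↑ʳ x

    vertex : Fin (m ℕ.* n2) → Fin n2
    vertex x = proj₁ (quotRem {m} n2 x)

    copy : Fin (m ℕ.* n2) → Fin m
    copy x = proj₂ (quotRem {m} n2 x)

    R = incidenceMatrix G1

    top≢bottom : ∀ u y → top u ≢ bottom y
    top≢bottom u y eq with trans (sym (Finₚ.splitAt-↑ˡ n1 u (m ℕ.* n2)))
                                 (trans (cong (splitAt n1) eq) (Finₚ.splitAt-↑ʳ n1 (m ℕ.* n2) y))
    ... | ()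

    copy-vertex-injective : ∀ x y → vertex x ≡ vertex y → copy x ≡ copy y → x ≡ y
    copy-vertex-injective x y vx≡vy cx≡cy =
      trans (sym (Finₚ.combine-remQuot {m} n2 x)) (trans (cong₂ Fin.combine cx≡cy vx≡vy) (Finₚ.combine-remQuot {m} n2 y))

  coronaAdj-top-top : ∀ u v → a (top u) (top v) ≡ adj G1 u v
  coronaAdj-top-top u v rewrite Finₚ.splitAt-↑ˡ n1 u (m ℕ.* n2) | Finₚ.splitAt-↑ˡ n1 v (m ℕ.* n2) = refl

  coronaAdj-top-bottom : ∀ u y → a (top u) (bottom y) ≡ isEndpoint u (lookup (edges G1) (copy y))
  coronaAdj-top-bottom u y rewrite Finₚ.splitAt-↑ˡ n1 u (m ℕ.* n2) | Finₚ.splitAt-↑ʳ n1 (m ℕ.* n2) y = refl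

  coronaAdj-bottom-top : ∀ x v → a (bottom x) (top v) ≡ isEndpoint v (lookup (edges G1) (copy x))
  coronaAdj-bottom-top x v rewrite Finₚ.splitAt-↑ʳ n1 (m ℕ.* n2) x | Finₚ.splitAt-↑ˡ n1 v (m ℕ.* n2) = refl

  coronaAdj-bottom-bottom : ∀ x y → a (bottom x) (bottom y) ≡ (⌊ copy x ≟ copy y ⌋ ∧ adj G2 (vertex x) (vertex y))
  coronaAdj-bottom-bottom x y rewrite Finₚ.splitAt-↑ʳ n1 (m ℕ.* n2) x | Finₚ.splitAt-↑ʳ n1 (m ℕ.* n2) y = refl

  corona-degree-top : ∀ u → degreeℚ a (top u) ≡ degreeℚ (adj G1) u + ℕtoℚ n2 * degreeℚ (adj G1) u
  corona-degree-top u =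
    trans (sum-splitAt n1 (m ℕ.* n2) (λ w → bool→ℚ (a (top u) w)))
          (cong₂ _+_ (sum-cong n1 (λ v → cong bool→ℚ (coronaAdj-top-top u v)))
                     (trans (sum-quotRem m n2 _ (λ _ i → R u i) (λ y → cong bool→ℚ (coronaAdj-top-bottom u y)))
                            (trans (sum-cong m (λ i → sum-const n2 (R u i)))
                                   (trans (*-distribˡ-sum m (ℕtoℚ n2) (R u)) (cong (ℕtoℚ n2 *_) (incidence-degree G1 u))))))

  corona-degree-bottom : ∀ x → degreeℚ a (bottom x) ≡ (1ℚ + 1ℚ) + degreeℚ (adj G2) (vertex x)
  corona-degree-bottom x =
    trans (sum-splitAt n1 (m ℕ.* n2) (λ w → bool→ℚ (a (bottom x) w)))
          (cong₂ _+_ (trans (sum-cong n1 (λ v → cong bool→ℚ (coronaAdj-bottom-top x v)))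
                            (sum-incidence n1 _ _ (edge-endpoints-distinct G1 (copy x))))
                     (trans (sum-quotRem m n2 _ (λ b i → bool→ℚ (⌊ copy x ≟ i ⌋ ∧ adj G2 (vertex x) b))
                                         (λ y → cong bool→ℚ (coronaAdj-bottom-bottom x y)))
                     (trans (sum-single m (copy x) _ (λ i i≢ → sum-zero n2 (λ b →
                               cong (λ t → bool→ℚ (t ∧ adj G2 (vertex x) b)) (⌊⌋-no (copy x ≟ i) (i≢ ∘ sym)))))
                            (sum-cong n2 (λ b → cong (λ t → bool→ℚ (t ∧ adj G2 (vertex x) b)) (⌊⌋-yes (copy x ≟ copy x) refl))))))

  module _ (x : ℚ) where

    private
      X = charMatrix a x
      B = charMatrix (adj G2) (x - ℕtoℚ 2)

    charMatrix-top-right : ∀ u y → X (top u) (bottom y) ≡ - R u (copy y)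
    charMatrix-top-right u y = trans (charMatrix-off a x _ _ (top≢bottom u y)) (cong (λ b → - bool→ℚ b) (coronaAdj-top-bottom u y))

    charMatrix-bottom-left : ∀ y v → X (bottom y) (top v) ≡ - R v (copy y)
    charMatrix-bottom-left y v = trans (charMatrix-off a x _ _ (top≢bottom v y ∘ sym)) (cong (λ b → - bool→ℚ b) (coronaAdj-bottom-top y v))

    charMatrix-bottom-right : ∀ y y' → X (bottom y) (bottom y') ≡ blockDiagonal m B y y'
    charMatrix-bottom-right y y' with y ≟ y'
    ... | yes refl =
      trans (charMatrix-diagonal a x (bottom y))
      (trans (cong₂ (λ d b → x - (d + bool→ℚ b)) (corona-degree-bottom y)
                    (trans (coronaAdj-bottom-bottom y y) (cong (_∧ adj G2 (vertex y) (vertex y)) (⌊⌋-yes (copy y ≟ copy y) refl))))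
      (trans (solve 3 (λ l d b → l :- ((con 1ℚ :+ con 1ℚ) :+ d :+ b) := (l :- (con 1ℚ :+ con 1ℚ)) :- (d :+ b)) refl
                      x (degreeℚ (adj G2) (vertex y)) (bool→ℚ (adj G2 (vertex y) (vertex y))))
      (trans (sym (charMatrix-diagonal (adj G2) (x - ℕtoℚ 2) (vertex y)))
             (sym (diagonalBlocks-same B (vertex y) (vertex y) (copy y))))))
    ... | no y≢y' =
      trans (charMatrix-off a x _ _ (y≢y' ∘ Finₚ.↑ʳ-injective n1 y y'))
            (trans (cong (λ b → - bool→ℚ b) (coronaAdj-bottom-bottom y y')) (same-or-other (copy y ≟ copy y')))
      where
      same-or-other : Dec (copy y ≡ copy y') →
        - bool→ℚ (⌊ copy y ≟ copy y' ⌋ ∧ adj G2 (vertex y) (vertex y')) ≡ blockDiagonal m B y y'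
      same-or-other (yes c≡c') rewrite ⌊⌋-yes (copy y ≟ copy y') c≡c' =
        sym (charMatrix-off (adj G2) _ (vertex y) (vertex y') (λ v≡v' → y≢y' (copy-vertex-injective y y' v≡v' c≡c')))
      same-or-other (no c≢c') rewrite ⌊⌋-no (copy y ≟ copy y') c≢c' = refl

    schur-top-left : ∀ r1 → Regular G1 r1 → (Γ μ : ℚ) → (1ℚ + Γ) * μ ≡ x - ℕtoℚ r1 * ℕtoℚ n2 →
      ∀ u v → X (top u) (top v) - Γ * sumFin m (λ i → R u i * R v i) ≡ (1ℚ + Γ) * charMatrix (adj G1) μ u v
    schur-top-left r1 regular Γ μ scaling u v = by-cases (u ≟ v)
      where
      open ≡-Reasoning
      r = ℕtoℚ r1
      degree : ∀ w → degreeℚ (adj G1) w ≡ r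
      degree w = trans (sym (degreeA≡degreeℚ n1 (adj G1) w)) (cong ℕtoℚ (regular w))
      by-cases : Dec (u ≡ v) → X (top u) (top v) - Γ * sumFin m (λ i → R u i * R v i) ≡ (1ℚ + Γ) * charMatrix (adj G1) μ u v
      by-cases (yes refl) = begin
        X (top u) (top u) - Γ * sumFin m (λ i → R u i * R u i)
          ≡⟨ cong₂ (λ t s → t - Γ * s) diagonal-entry (trans (incidence-gram-≡ G1 u) (degree u)) ⟩
        x - (r + ℕtoℚ n2 * r + 0ℚ) - Γ * r
          ≡⟨ solve 4 (λ x r n g → x :- (r :+ n :* r :+ con 0ℚ) :- g :* r := (x :- r :* n) :- (con 1ℚ :+ g) :* r) refl x r (ℕtoℚ n2) Γ ⟩
        (x - r * ℕtoℚ n2) - (1ℚ + Γ) * r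
          ≡⟨ cong (_- (1ℚ + Γ) * r) (sym scaling) ⟩
        (1ℚ + Γ) * μ - (1ℚ + Γ) * r
          ≡⟨ solve 3 (λ g m r → (con 1ℚ :+ g) :* m :- (con 1ℚ :+ g) :* r := (con 1ℚ :+ g) :* (m :- r)) refl Γ μ r ⟩
        (1ℚ + Γ) * (μ - r)
          ≡⟨ cong (λ d → (1ℚ + Γ) * (μ - d)) (sym (degree u)) ⟩
        (1ℚ + Γ) * (μ - degreeℚ (adj G1) u)
          ≡⟨ cong ((1ℚ + Γ) *_) (sym (charMatrix-simple-diagonal G1 μ u)) ⟩
        (1ℚ + Γ) * charMatrix (adj G1) μ u u ∎
        where
        diagonal-entry : X (top u) (top u) ≡ x - (r + ℕtoℚ n2 * r + 0ℚ)
        diagonal-entry =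
          trans (charMatrix-diagonal a x (top u))
                (cong₂ (λ d b → x - (d + bool→ℚ b))
                       (trans (corona-degree-top u) (cong (λ d → d + ℕtoℚ n2 * d) (degree u)))
                       (trans (coronaAdj-top-top u u) (irrefl G1 u)))
      by-cases (no u≢v) = begin
        X (top u) (top v) - Γ * sumFin m (λ i → R u i * R v i)
          ≡⟨ cong₂ (λ t s → t - Γ * s)
                   (trans (charMatrix-off a x _ _ (u≢v ∘ Finₚ.↑ˡ-injective (m ℕ.* n2) u v)) (cong (λ b → - bool→ℚ b) (coronaAdj-top-top u v)))
                   (incidence-gram-≢ G1 u v u≢v) ⟩
        - bool→ℚ (adj G1 u v) - Γ * bool→ℚ (adj G1 u v)
          ≡⟨ solve 2 (λ g b → :- b :- g :* b := (con 1ℚ :+ g) :* (:- b)) refl Γ (bool→ℚ (adj G1 u v)) ⟩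
        (1ℚ + Γ) * - bool→ℚ (adj G1 u v)
          ≡⟨ cong ((1ℚ + Γ) *_) (sym (charMatrix-off (adj G1) μ u v u≢v)) ⟩
        (1ℚ + Γ) * charMatrix (adj G1) μ u v ∎

  fQcorona-factorization : ∀ x r1 → Regular G1 r1 →
    (z : Fin n2 → ℚ) → (∀ b → sumFin n2 (λ p → z p * charMatrix (adj G2) (x - ℕtoℚ 2) p b) ≡ 1ℚ) →
    (μ : ℚ) → (1ℚ + sumFin n2 z) * μ ≡ x - ℕtoℚ r1 * ℕtoℚ n2 →
    fQcorona G1 G2 x ≡ (1ℚ + sumFin n2 z) ^ n1 * fQ G1 μ * fQ G2 (x - ℕtoℚ 2) ^ m
  fQcorona-factorization x r1 regular z zB≡1 μ scaling =
    trans (det-schur-complement n1 m n2 (charMatrix a x) R (charMatrix (adj G2) (x - ℕtoℚ 2)) z zB≡1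
             (charMatrix-top-right x) (charMatrix-bottom-left x) (charMatrix-bottom-right x))
          (cong (_* fQ G2 (x - ℕtoℚ 2) ^ m)
                (trans (det-cong n1 (schur-top-left x r1 regular (sumFin n2 z) μ scaling))
                       (det-scale n1 (1ℚ + sumFin n2 z) (charMatrix (adj G1) μ))))

charMatrix-solve-ones : ∀ {n} (G : SimpleGraph n) x → fQ G x ≢ 0ℚ →
  Σ[ z ∈ (Fin n → ℚ) ] (∀ b → sumFin n (λ p → z p * charMatrix (adj G) x p b) ≡ 1ℚ)
charMatrix-solve-ones {n} G x f≢0 =
  proj₁ solution , λ b → trans (sum-cong n (λ p → trans (*-comm (proj₁ solution p) _) (cong (_* proj₁ solution p) (charMatrix-symmetric G x p b))))
                               (proj₂ solution b)
  where
  solution = solve-ones n (charMatrix (adj G) x) f≢0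

fQbar-factorization : ∀ {n} (G : SimpleGraph n) x (z : Fin n → ℚ) →
  (∀ b → sumFin n (λ p → z p * charMatrix (adj G) (x - ℕtoℚ 2) p b) ≡ 1ℚ) →
  fQbar G (ℕtoℚ n - x) ≡ (- 1ℚ) ^ n * ((1ℚ + sumFin n z) * fQ G (x - ℕtoℚ 2))
fQbar-factorization {n} G x z zB≡1 =
  trans (det-cong n (charMatrix-complement G x))
        (trans (det-scale n (- 1ℚ) (λ p q → charMatrix (adj G) (x - ℕtoℚ 2) p q + 1ℚ))
               (cong ((- 1ℚ) ^ n *_) (det-+-ones n (charMatrix (adj G) (x - ℕtoℚ 2)) z zB≡1)))

*-÷-cancel : ∀ γ s L f f̄ .{{_ : ℚ.NonZero f̄}} → f̄ ≡ s * (γ * f) → γ * ((s * (L * f)) ÷ f̄) ≡ L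
*-÷-cancel γ s L f f̄ f̄≡ = begin
  γ * ((s * (L * f)) * 1/ f̄)  ≡⟨ solve 5 (λ g s l f i → g :* ((s :* (l :* f)) :* i) := l :* (s :* (g :* f)) :* i) refl γ s L f (1/ f̄) ⟩
  L * (s * (γ * f)) * 1/ f̄    ≡⟨ cong (λ t → L * t * 1/ f̄) (sym f̄≡) ⟩
  L * f̄ * 1/ f̄               ≡⟨ solve 3 (λ l b i → l :* b :* i := l :* (b :* i)) refl L f̄ (1/ f̄) ⟩
  L * (f̄ * 1/ f̄)             ≡⟨ cong (L *_) (*-inverseʳ f̄) ⟩
  L * 1ℚ                      ≡⟨ *-identityʳ L ⟩
  L                           ∎
  where open ≡-Reasoning

÷-cancel-sign : ∀ γ s f f̄ .{{_ : ℚ.NonZero f}} → s * s ≡ 1ℚ → f̄ ≡ s * (γ * f) → (s * f̄) ÷ f ≡ γ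
÷-cancel-sign γ s f f̄ s²≡1 f̄≡ = begin
  (s * f̄) * 1/ f               ≡⟨ cong (λ t → (s * t) * 1/ f) f̄≡ ⟩
  (s * (s * (γ * f))) * 1/ f   ≡⟨ solve 4 (λ s g f i → (s :* (s :* (g :* f))) :* i := (s :* s) :* g :* (f :* i)) refl s γ f (1/ f) ⟩
  (s * s) * γ * (f * 1/ f)     ≡⟨ cong₂ (λ a b → a * γ * b) s²≡1 (*-inverseʳ f) ⟩
  1ℚ * γ * 1ℚ                  ≡⟨ solve 1 (λ g → con 1ℚ :* g :* con 1ℚ := g) refl γ ⟩
  γ                            ∎
  where open ≡-Reasoning

theorem2p12 : ∀ {n1 n2 : ℕ} (G1 : SimpleGraph n1) (G2 : SimpleGraph n2) (r1 m1 m2 : ℕ) →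
    Connected G1 → Regular G1 r1 → numEdges G1 ≡ m1 →
    Connected G2 → numEdges G2 ≡ m2 →
    (λ' : ℚ) →
    (p2 : fQ G2 (λ' - ℕtoℚ 2) ≢ 0ℚ) →
    (pb : fQbar G2 (ℕtoℚ n2 - λ') ≢ 0ℚ) →
    fQcorona G1 G2 λ'
      ≡ (fQ G2 (λ' - ℕtoℚ 2) ^ m1)
        * fQ G1 (_÷_ (((- 1ℚ) ^ n2) * ((λ' - ℕtoℚ (r1 ℕ.* n2)) * fQ G2 (λ' - ℕtoℚ 2)))
                     (fQbar G2 (ℕtoℚ n2 - λ')) {{≢-nonZero pb}})
        * (_÷_ (((- 1ℚ) ^ n2) * fQbar G2 (ℕtoℚ n2 - λ'))
               (fQ G2 (λ' - ℕtoℚ 2)) {{≢-nonZero p2}} ^ n1)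
theorem2p12 {n1} {n2} G1 G2 r1 _ _ _ regular refl _ _ λ' f₂≢0 f̄≢0 = begin
  fQcorona G1 G2 λ'                ≡⟨ fQcorona-factorization G1 G2 λ' r1 regular z zB≡1 μ scaling ⟩
  γ ^ n1 * fQ G1 μ * f₂ ^ m        ≡⟨ cong (λ t → t ^ n1 * fQ G1 μ * f₂ ^ m) (sym ratio) ⟩
  ρ ^ n1 * fQ G1 μ * f₂ ^ m        ≡⟨ solve 3 (λ a b c → a :* b :* c := c :* b :* a) refl (ρ ^ n1) (fQ G1 μ) (f₂ ^ m) ⟩
  f₂ ^ m * fQ G1 μ * ρ ^ n1        ∎
  where
  open ≡-Reasoning
  m = numEdges G1
  f₂ = fQ G2 (λ' - ℕtoℚ 2)
  f̄ = fQbar G2 (ℕtoℚ n2 - λ')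
  μ = (_÷_ (sign n2 * ((λ' - ℕtoℚ (r1 ℕ.* n2)) * f₂)) f̄) {{≢-nonZero f̄≢0}}
  ρ = (_÷_ (sign n2 * f̄) f₂) {{≢-nonZero f₂≢0}}
  z = proj₁ (charMatrix-solve-ones G2 (λ' - ℕtoℚ 2) f₂≢0)
  zB≡1 = proj₂ (charMatrix-solve-ones G2 (λ' - ℕtoℚ 2) f₂≢0)
  γ = 1ℚ + sumFin n2 z
  f̄≡ : f̄ ≡ sign n2 * (γ * f₂)
  f̄≡ = fQbar-factorization G2 λ' z zB≡1
  scaling : γ * μ ≡ λ' - ℕtoℚ r1 * ℕtoℚ n2
  scaling = trans (*-÷-cancel γ (sign n2) (λ' - ℕtoℚ (r1 ℕ.* n2)) f₂ f̄ {{≢-nonZero f̄≢0}} f̄≡)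
                  (cong (λ t → λ' - t) (ℕtoℚ-* r1 n2))
  ratio : ρ ≡ γ
  ratio = ÷-cancel-sign γ (sign n2) f₂ f̄ {{≢-nonZero f₂≢0}} (sign-*-sign n2) f̄≡
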